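{- Let $w$ be a Baxter permutation of length $n$ that is fixed under $90^{\circ}$ rotation, and let $p$ be a position such that inserting a new largest entry $n+1$ into $w$ at position $p$ (i.e. between the same consecutive entries of $w$, or at an end) yields a Baxter permutation. Then it is possible to additionally insert a new smallest entry, a new first entry and a new last entry so that the result is a Baxter permutation $w'$ of length $n+4$ that is fixed under $90^{\circ}$ rotation; that is, there is a Baxter permutation $w'$ of length $n+4$ fixed under $90^{\circ}$ rotation such that deleting from $w'$ its largest entry, its smallest entry, its first entry and its last entry (and standardizing the remaining entries to $[n]$) gives $w$, and in which the largest entry $n+4$ lies in the same gap between entries originating from $w$ as the inserted $n+1$ occupies at position $p$.
   Context: A permutation $w=w_1\ldots w_n$ is a Baxter permutation if there are no indices $i<j<j+1<k$ with $w_j<w_k<w_i<w_{j+1}$ (pattern 3-14-2) and no indices $i<j<j+1<k$ with $w_{j+1}<w_i<w_k<w_j$ (pattern 2-41-3). A permutation $w$ of length $n$ is fixed under $90^{\circ}$ rotation (of its permutation matrix) if for all $i$, $w_i=j$ implies $w_j=n+1-i$ (equivalently $w_{w_i}=n+1-i$ for all $i$). Inserting a new smallest entry means increasing all entries by $1$ and inserting $1$ somewhere; inserting a new first (resp. last) entry $j$ means increasing all entries $\ge j$ by $1$ and prepending (resp. appending) $j$. -}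

module Defs where

open import Data.Nat using (ℕ; zero; suc; _<_; _≤_; _∸_; _≟_; _<?_)
open import Data.List using (List; []; _∷_; _++_; length; take; drop; map; filter; applyUpTo)
open import Data.List.Relation.Binary.Permutation.Propositional using (_↭_)
open import Data.Product using (_×_)
open import Relation.Nullary using (¬_)
open import Relation.Nullary.Decidable using (¬?)
open import Relation.Binary.PropositionalEquality using (_≡_)

IsPerm : ℕ → List ℕ → Set
IsPerm n w = w ↭ applyUpTo suc n

-- 0-based lookup with default 0 (only used in range).
at : List ℕ → ℕ → ℕ
at []       _       = 0
at (x ∷ xs) zero    = x
at (x ∷ xs) (suc i) = at xs i

-- Baxter: no 0-based indices i < j, j+1 < k < length w with
-- w_j < w_k < w_i < w_{j+1}  (3-14-2)  or  w_{j+1} < w_i < w_k < w_j  (2-41-3).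
Baxter : List ℕ → Set
Baxter w = ∀ i j k → i < j → suc j < k → k < length w →
  ¬ (at w j < at w k × at w k < at w i × at w i < at w (suc j)) ×
  ¬ (at w (suc j) < at w i × at w i < at w k × at w k < at w j)

-- Fixed under 90° rotation: w_{w_i} = n+1-i (1-based).  With 0-based position
-- i (1-based position i+1) this reads  at w (w_i - 1) = n - i.
RotFixed : List ℕ → Set
RotFixed w = ∀ i → i < length w → at w (at w i ∸ 1) ≡ length w ∸ i

insertAt : ℕ → ℕ → List ℕ → List ℕ
insertAt p x w = take p w ++ x ∷ drop p w

standardize : List ℕ → List ℕ
standardize u = map (λ x → suc (length (filter (_<? x) u))) u

removeOne : List ℕ → List ℕ
removeOne = filter (λ x → ¬? (x ≟ 1))

-- Write w in 0-based form v; rotation-fixedness says that v ∘ v is the complement i ↦ n - 1 - i.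
-- A rotation-fixed Baxter permutation has odd length, and reversal preserves both properties, so the
-- gap p may be assumed to lie in the left half; let K = n - 1 - p be its mirror image. The extension
-- w′ starts with p + 2, ends with K + 4, has n + 4 in gap p and 1 right after position K of w, the
-- old entries being relabelled accordingly; a direct computation shows that w′ is fixed under rotation.
-- For the Baxter property the four entries are inserted one at a time into w with doubled values (so
-- that all new values are fresh). The maximum is safe by hypothesis and the minimum by the rotated
-- hypothesis. A pattern through the new first or last entry and two adjacent positions q, q + 1 of w
-- involves the positions v q, v (q + 1), which carry consecutive values; it either contradicts the
-- hypotheses or makes a segment cross that value gap, and the crossing step completes a forbidden
-- pattern.
module Submission where

open import Defs
open import Data.Nat using (ℕ; zero; suc; _+_; _∸_; _<_; _≤_; z≤n; s≤s; _<?_; _≤?_; _≟_; pred; ⌊_/2⌋)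
open import Data.Nat.Properties
open import Data.List using (List; []; _∷_; _++_; length; take; drop; map; filter; applyUpTo; reverse)
open import Data.List.Properties
  using (length-map; length-++; length-applyUpTo; applyUpTo-∷ʳ; take++drop≡id; filter-++; filter-all; filter-accept; filter-reject;
         ++-identityʳ; ++-assoc; map-++; map-∘; map-cong; map-id-local; length-drop; length-reverse;
         unfold-reverse; reverse-++; reverse-map; reverse-involutive)
open import Data.List.Relation.Unary.All using (All; _∷_)
import Data.List.Relation.Unary.All.Properties as All
open import Data.List.Relation.Unary.Any using (here; there)
open import Data.List.Membership.Propositional using (_∈_)
open import Data.List.Membership.Propositional.Properties using (∈-++⁺ʳ; ∈-applyUpTo⁻)
open import Data.List.Relation.Binary.Permutation.Propositional
  using (_↭_; ↭-refl; ↭-reflexive; ↭-sym; ↭-trans; prep; swap; module PermutationReasoning)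
open import Data.List.Relation.Binary.Permutation.Propositional.Properties
  using (↭-length; filter-↭; All-resp-↭; ∈-resp-↭; ++⁺ʳ; ++-comm; map⁺; ↭-reverse) renaming (shift to ↭-shift)
open import Data.Product using (_×_; _,_; proj₁; proj₂; ∃-syntax)
open import Data.Sum using (_⊎_; inj₁; inj₂)
open import Data.Empty using (⊥; ⊥-elim)
open import Relation.Nullary using (¬_; Dec; yes; no)
open import Relation.Nullary.Decidable using (¬?)
open import Relation.Binary.PropositionalEquality
  using (_≡_; _≢_; refl; sym; trans; cong; cong₂; subst; subst₂; ≢-sym; module ≡-Reasoning)
open import Relation.Binary.Definitions using (Tri; tri<; tri≈; tri>)

-- Arithmetic

Monotone : (ℕ → ℕ) → Set
Monotone f = ∀ {x y} → x ≤ y → f x ≤ f y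

StrictlyMonotone : (ℕ → ℕ) → Set
StrictlyMonotone g = ∀ {x y} → x < y → g x < g y

monotone-reflects-< : ∀ f → Monotone f → ∀ {x y} → f x < f y → x < y
monotone-reflects-< f mono {x} {y} fx<fy with x <? y
... | yes x<y = x<y
... | no  x≮y = ⊥-elim (<⇒≱ fx<fy (mono (≮⇒≥ x≮y)))

strictly-monotone-reflects-< : ∀ g → StrictlyMonotone g → ∀ {x y} → g x < g y → x < y
strictly-monotone-reflects-< g g-mono {x} {y} gx<gy with <-cmp x y
... | tri< x<y _ _ = x<y
... | tri≈ _ refl _ = ⊥-elim (<-irrefl refl gx<gy)
... | tri> _ _ y<x = ⊥-elim (<-asym gx<gy (g-mono y<x))

complement : ℕ → ℕ → ℕ
complement n x = n ∸ suc x

m∸n≡1+m∸[1+n] : ∀ m n → n < m → m ∸ n ≡ suc (m ∸ suc n)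
m∸n≡1+m∸[1+n] (suc m) zero    _         = refl
m∸n≡1+m∸[1+n] (suc m) (suc n) (s≤s n<m) = m∸n≡1+m∸[1+n] m n n<m

positive⇒suc : ∀ {m} → 0 < m → ∃[ m′ ] m ≡ suc m′
positive⇒suc {suc m} _ = m , refl

module Complement (n : ℕ) where

  c : ℕ → ℕ
  c = complement n

  c-< : ∀ {x} → x < n → c x < n
  c-< {x} (s≤s _) = s≤s (m∸n≤m _ x)

  c-involutive : ∀ {x} → x < n → c (c x) ≡ x
  c-involutive (s≤s x≤n-1) = m∸[m∸n]≡n x≤n-1

  c-reverses-< : ∀ {x y} → x < y → y < n → c y < c x
  c-reverses-< x<y (s≤s y≤n-1) = ∸-monoʳ-< x<y y≤n-1

  c-reverses-≤ : ∀ {x y} → x ≤ y → c y ≤ c x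
  c-reverses-≤ x≤y = ∸-monoʳ-≤ n (s≤s x≤y)

  c-suc : ∀ {x} → suc x < n → c x ≡ suc (c (suc x))
  c-suc {x} x+1<n = m∸n≡1+m∸[1+n] n (suc x) x+1<n

double : ℕ → ℕ
double zero    = zero
double (suc x) = suc (suc (double x))

double-mono-≤ : ∀ {x y} → x ≤ y → double x ≤ double y
double-mono-≤ z≤n       = z≤n
double-mono-≤ (s≤s x≤y) = s≤s (s≤s (double-mono-≤ x≤y))

double-mono-< : ∀ {x y} → x < y → double x < double y
double-mono-< {zero}  (s≤s _)   = s≤s z≤n
double-mono-< {suc x} (s≤s x<y) = s≤s (s≤s (double-mono-< x<y))

even<odd⇒< : ∀ x y → suc (suc (double x)) < suc (double y) → x < y
even<odd⇒< x       zero    (s≤s ())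
even<odd⇒< zero    (suc y) _ = s≤s z≤n
even<odd⇒< (suc x) (suc y) (s≤s (s≤s (s≤s h))) = s≤s (even<odd⇒< x y (s≤s h))

odd<even⇒≤ : ∀ x y → suc (double y) < suc (suc (double x)) → y ≤ x
odd<even⇒≤ x       zero    _ = z≤n
odd<even⇒≤ zero    (suc y) (s≤s (s≤s ()))
odd<even⇒≤ (suc x) (suc y) (s≤s (s≤s (s≤s h))) = s≤s (odd<even⇒≤ x y (s≤s h))

even<even⇒< : ∀ x y → suc (suc (double x)) < suc (suc (double y)) → x < y
even<even⇒< x y (s≤s (s≤s h)) = monotone-reflects-< double double-mono-≤ h

step : ℕ → ℕ → ℕ
step zero    _       = 1
step (suc a) zero    = 0
step (suc a) (suc x) = step a x

step-mono : ∀ a → Monotone (step a)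
step-mono zero    _         = ≤-refl
step-mono (suc a) {zero}    _         = z≤n
step-mono (suc a) {suc x} (s≤s x≤y) = step-mono a x≤y

step-≥ : ∀ {a x} → a ≤ x → step a x ≡ 1
step-≥ {zero}  _         = refl
step-≥ {suc a} (s≤s a≤x) = step-≥ a≤x

step-< : ∀ {a x} → x < a → step a x ≡ 0
step-< {suc a} {zero}  _         = refl
step-< {suc a} {suc x} (s≤s x<a) = step-< x<a

⌊double/2⌋ : ∀ x → ⌊ double x /2⌋ ≡ x
⌊double/2⌋ zero    = refl
⌊double/2⌋ (suc x) = cong suc (⌊double/2⌋ x)

⌊1+double/2⌋ : ∀ x → ⌊ suc (double x) /2⌋ ≡ x
⌊1+double/2⌋ zero    = refl
⌊1+double/2⌋ (suc x) = cong suc (⌊1+double/2⌋ x)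

-- Lists

at-insertAt-< : ∀ t x u y → y < t → t ≤ length u → at (insertAt t x u) y ≡ at u y
at-insertAt-< (suc t) x (a ∷ u) zero    _         _         = refl
at-insertAt-< (suc t) x (a ∷ u) (suc y) (s≤s y<t) (s≤s t≤u) = at-insertAt-< t x u y y<t t≤u

at-insertAt-≡ : ∀ t x u → t ≤ length u → at (insertAt t x u) t ≡ x
at-insertAt-≡ zero    x u       _         = refl
at-insertAt-≡ (suc t) x (a ∷ u) (s≤s t≤u) = at-insertAt-≡ t x u t≤u

at-insertAt-> : ∀ t x u y → t ≤ y → t ≤ length u → at (insertAt t x u) (suc y) ≡ at u y
at-insertAt-> zero    x u       y       _         _         = refl
at-insertAt-> (suc t) x (a ∷ u) (suc y) (s≤s t≤y) (s≤s t≤u) = at-insertAt-> t x u y t≤y t≤u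

length-insertAt : ∀ t x u → t ≤ length u → length (insertAt t x u) ≡ suc (length u)
length-insertAt zero    x u       _         = refl
length-insertAt (suc t) x (a ∷ u) (s≤s t≤u) = cong suc (length-insertAt t x u t≤u)

at-map : ∀ (f : ℕ → ℕ) u y → y < length u → at (map f u) y ≡ f (at u y)
at-map f (a ∷ u) zero    _         = refl
at-map f (a ∷ u) (suc y) (s≤s y<u) = at-map f u y y<u

at-++ˡ : ∀ u l y → y < length u → at (u ++ l) y ≡ at u y
at-++ˡ (a ∷ u) l zero    _         = refl
at-++ˡ (a ∷ u) l (suc y) (s≤s y<u) = at-++ˡ u l y y<u

at-length-++ : ∀ u x l → at (u ++ x ∷ l) (length u) ≡ x
at-length-++ []      x l = refl
at-length-++ (a ∷ u) x l = at-length-++ u x l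

at-applyUpTo : ∀ (f : ℕ → ℕ) m y → y < m → at (applyUpTo f m) y ≡ f y
at-applyUpTo f (suc m) zero    _         = refl
at-applyUpTo f (suc m) (suc y) (s≤s y<m) = at-applyUpTo (λ z → f (suc z)) m y y<m

at-∈ : ∀ (l : List ℕ) i → i < length l → at l i ∈ l
at-∈ (x ∷ l) zero    _         = here refl
at-∈ (x ∷ l) (suc i) (s≤s i<l) = there (at-∈ l i i<l)

at-reverse : ∀ (l : List ℕ) i → i < length l → at (reverse l) i ≡ at l (length l ∸ suc i)
at-reverse (x ∷ l) i i<l+1 with m≤n⇒m<n∨m≡n (≤-pred i<l+1)
... | inj₁ i<l = begin
  at (reverse (x ∷ l)) i      ≡⟨ cong (λ xs → at xs i) (unfold-reverse x l) ⟩
  at (reverse l ++ x ∷ []) i  ≡⟨ at-++ˡ (reverse l) (x ∷ []) i (subst (i <_) (sym (length-reverse l)) i<l) ⟩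
  at (reverse l) i            ≡⟨ at-reverse l i i<l ⟩
  at l (length l ∸ suc i)     ≡⟨ cong (at (x ∷ l)) (m∸n≡1+m∸[1+n] (length l) i i<l) ⟨
  at (x ∷ l) (length l ∸ i)   ∎
  where open ≡-Reasoning
... | inj₂ refl = begin
  at (reverse (x ∷ l)) (length l)             ≡⟨ cong (λ xs → at xs (length l)) (unfold-reverse x l) ⟩
  at (reverse l ++ x ∷ []) (length l)         ≡⟨ subst (λ t → at (reverse l ++ x ∷ []) t ≡ x) (length-reverse l)
                                                       (at-length-++ (reverse l) x []) ⟩
  x                                           ≡⟨ cong (at (x ∷ l)) (n∸n≡0 (length l)) ⟨
  at (x ∷ l) (length l ∸ length l)            ∎
  where open ≡-Reasoning

at-extensionality : ∀ (l l′ : List ℕ) → length l ≡ length l′ →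
                    (∀ y → y < length l → at l y ≡ at l′ y) → l ≡ l′
at-extensionality []      []       _ _ = refl
at-extensionality (a ∷ l) (b ∷ l′) e h =
  cong₂ _∷_ (h 0 (s≤s z≤n)) (at-extensionality l l′ (suc-injective e) (λ y y<l → h (suc y) (s≤s y<l)))

map-insertAt : ∀ (f : ℕ → ℕ) t x u → map f (insertAt t x u) ≡ insertAt t (f x) (map f u)
map-insertAt f zero    x u       = refl
map-insertAt f (suc t) x []      = refl
map-insertAt f (suc t) x (a ∷ u) = cong (f a ∷_) (map-insertAt f t x u)

insertAt-length : ∀ x (u : List ℕ) → insertAt (length u) x u ≡ u ++ x ∷ []
insertAt-length x []      = refl
insertAt-length x (a ∷ u) = cong (a ∷_) (insertAt-length x u)

insertAt-↭ : ∀ t x (u : List ℕ) → insertAt t x u ↭ x ∷ u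
insertAt-↭ t x u =
  ↭-trans (↭-shift x (take t u) (drop t u)) (prep x (↭-reflexive (take++drop≡id t u)))

∈-insertAt : ∀ t x (u : List ℕ) → x ∈ insertAt t x u
∈-insertAt t x u = ∈-++⁺ʳ (take t u) (here refl)

All-insertAt : ∀ {P : ℕ → Set} t x u → P x → All P u → All P (insertAt t x u)
All-insertAt t x u px pu = All.++⁺ (All.take⁺ t pu) (px ∷ All.drop⁺ t pu)

removeOne-insertAt : ∀ t u → All (_≢ 1) u → removeOne (insertAt t 1 u) ≡ u
removeOne-insertAt t u u≢1 = begin
  filter ≢1? (take t u ++ 1 ∷ drop t u)            ≡⟨ filter-++ ≢1? (take t u) (1 ∷ drop t u) ⟩
  filter ≢1? (take t u) ++ filter ≢1? (1 ∷ drop t u) ≡⟨ cong₂ _++_ (filter-all ≢1? (All.take⁺ t u≢1))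
                                                          (trans (filter-reject ≢1? {xs = drop t u} (λ 1≢1 → 1≢1 refl))
                                                                 (filter-all ≢1? (All.drop⁺ t u≢1))) ⟩
  take t u ++ drop t u                              ≡⟨ take++drop≡id t u ⟩
  u                                                 ∎
  where
  open ≡-Reasoning
  ≢1? = λ x → ¬? (x ≟ 1)

take-length-++ : ∀ (xs ys : List ℕ) → take (length xs) (xs ++ ys) ≡ xs
take-length-++ []       ys = refl
take-length-++ (x ∷ xs) ys = cong (x ∷_) (take-length-++ xs ys)

drop-length-++ : ∀ (xs ys : List ℕ) → drop (length xs) (xs ++ ys) ≡ ys
drop-length-++ []       ys = refl
drop-length-++ (x ∷ xs) ys = drop-length-++ xs ys

reverse-insertAt : ∀ t x (u : List ℕ) → reverse (insertAt t x u) ≡ insertAt (length u ∸ t) x (reverse u)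
reverse-insertAt t x u = begin
  reverse (take t u ++ x ∷ drop t u)              ≡⟨ reverse-++ (take t u) (x ∷ drop t u) ⟩
  reverse (x ∷ drop t u) ++ reverse (take t u)    ≡⟨ cong (_++ reverse (take t u)) (unfold-reverse x (drop t u)) ⟩
  (reverse (drop t u) ++ x ∷ []) ++ reverse (take t u) ≡⟨ ++-assoc (reverse (drop t u)) (x ∷ []) (reverse (take t u)) ⟩
  reverse (drop t u) ++ x ∷ reverse (take t u)    ≡⟨ cong₂ (λ as bs → as ++ x ∷ bs)
                                                        (take-length-++ (reverse (drop t u)) (reverse (take t u)))
                                                        (drop-length-++ (reverse (drop t u)) (reverse (take t u))) ⟨
  insertAt (length (reverse (drop t u))) x (reverse (drop t u) ++ reverse (take t u))
    ≡⟨ cong₂ (λ s us → insertAt s x us) (trans (length-reverse (drop t u)) (length-drop t u))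
             (trans (sym (reverse-++ (take t u) (drop t u))) (cong reverse (take++drop≡id t u))) ⟩
  insertAt (length u ∸ t) x (reverse u)           ∎
  where open ≡-Reasoning

filter-reverse : ∀ {P : ℕ → Set} (P? : ∀ x → Dec (P x)) xs → filter P? (reverse xs) ≡ reverse (filter P? xs)
filter-reverse P? []       = refl
filter-reverse P? (x ∷ xs) with P? x
... | yes px = begin
  filter P? (reverse (x ∷ xs))                 ≡⟨ cong (filter P?) (unfold-reverse x xs) ⟩
  filter P? (reverse xs ++ x ∷ [])             ≡⟨ filter-++ P? (reverse xs) (x ∷ []) ⟩
  filter P? (reverse xs) ++ filter P? (x ∷ []) ≡⟨ cong₂ _++_ (filter-reverse P? xs) (filter-accept P? {xs = []} px) ⟩
  reverse (filter P? xs) ++ x ∷ []             ≡⟨ unfold-reverse x (filter P? xs) ⟨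
  reverse (x ∷ filter P? xs)                   ∎
  where open ≡-Reasoning
... | no ¬px = begin
  filter P? (reverse (x ∷ xs))                 ≡⟨ cong (filter P?) (unfold-reverse x xs) ⟩
  filter P? (reverse xs ++ x ∷ [])             ≡⟨ filter-++ P? (reverse xs) (x ∷ []) ⟩
  filter P? (reverse xs) ++ filter P? (x ∷ []) ≡⟨ cong₂ _++_ (filter-reverse P? xs) (filter-reject P? {xs = []} ¬px) ⟩
  reverse (filter P? xs) ++ []                 ≡⟨ ++-identityʳ (reverse (filter P? xs)) ⟩
  reverse (filter P? xs)                       ∎
  where open ≡-Reasoning

-- Standardization

count<-map : ∀ g → StrictlyMonotone g → ∀ xs x →
             length (filter (_<? g x) (map g xs)) ≡ length (filter (_<? x) xs)
count<-map g g-mono []       x = refl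
count<-map g g-mono (y ∷ ys) x with g y <? g x | y <? x
... | yes gy<gx   | yes y<x
  rewrite filter-accept (_<? g x) {xs = map g ys} gy<gx | filter-accept (_<? x) {xs = ys} y<x =
  cong suc (count<-map g g-mono ys x)
... | no  gy≮gx   | no  y≮x
  rewrite filter-reject (_<? g x) {xs = map g ys} gy≮gx | filter-reject (_<? x) {xs = ys} y≮x =
  count<-map g g-mono ys x
... | yes gy<gx   | no y≮x = ⊥-elim (y≮x (strictly-monotone-reflects-< g g-mono gy<gx))
... | no  gy≮gx   | yes y<x = ⊥-elim (gy≮gx (g-mono y<x))

count<-applyUpTo : ∀ z d → length (filter (_<? suc z) (applyUpTo suc (z + d))) ≡ z
count<-applyUpTo z zero = begin
  length (filter (_<? suc z) (applyUpTo suc (z + 0))) ≡⟨ cong (λ m → length (filter (_<? suc z) (applyUpTo suc m))) (+-identityʳ z) ⟩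
  length (filter (_<? suc z) (applyUpTo suc z))       ≡⟨ cong length (filter-all (_<? suc z) (All.applyUpTo⁺₁ suc z s≤s)) ⟩
  length (applyUpTo suc z)                            ≡⟨ length-applyUpTo suc z ⟩
  z                                                   ∎
  where open ≡-Reasoning
count<-applyUpTo z (suc d) = begin
  length (filter (_<? suc z) (applyUpTo suc (z + suc d)))
    ≡⟨ cong (λ xs → length (filter (_<? suc z) xs)) (trans (cong (applyUpTo suc) (+-suc z d)) (sym (applyUpTo-∷ʳ suc (z + d)))) ⟩
  length (filter (_<? suc z) (applyUpTo suc (z + d) ++ suc (z + d) ∷ []))
    ≡⟨ cong length (filter-++ (_<? suc z) (applyUpTo suc (z + d)) (suc (z + d) ∷ [])) ⟩
  length (filter (_<? suc z) (applyUpTo suc (z + d)) ++ filter (_<? suc z) (suc (z + d) ∷ []))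
    ≡⟨ cong (λ xs → length (filter (_<? suc z) (applyUpTo suc (z + d)) ++ xs))
            (filter-reject (_<? suc z) {xs = []} (≤⇒≯ (s≤s (m≤m+n z d)))) ⟩
  length (filter (_<? suc z) (applyUpTo suc (z + d)) ++ [])
    ≡⟨ cong length (++-identityʳ (filter (_<? suc z) (applyUpTo suc (z + d)))) ⟩
  length (filter (_<? suc z) (applyUpTo suc (z + d)))
    ≡⟨ count<-applyUpTo z d ⟩
  z ∎
  where open ≡-Reasoning

standardize-map : ∀ g → StrictlyMonotone g → ∀ u → standardize (map g u) ≡ standardize u
standardize-map g g-mono u = trans (sym (map-∘ u)) (map-cong (λ x → cong suc (count<-map g g-mono u x)) u)

standardize-perm : ∀ n w → IsPerm n w → standardize w ≡ w
standardize-perm n w w↭ = map-id-local (All-resp-↭ (↭-sym w↭) (All.applyUpTo⁺₁ suc n rank))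
  where
  rank : ∀ {i} → i < n → suc (length (filter (_<? suc i) w)) ≡ suc i
  rank {i} i<n = cong suc (begin
    length (filter (_<? suc i) w)                             ≡⟨ ↭-length (filter-↭ (_<? suc i) w↭) ⟩
    length (filter (_<? suc i) (applyUpTo suc n))             ≡⟨ cong (λ m → length (filter (_<? suc i) (applyUpTo suc m)))
                                                                      (sym (m+[n∸m]≡n (<⇒≤ i<n))) ⟩
    length (filter (_<? suc i) (applyUpTo suc (i + (n ∸ i)))) ≡⟨ count<-applyUpTo i (n ∸ i) ⟩
    i                                                         ∎)
    where open ≡-Reasoning

standardize-reverse : ∀ u → standardize (reverse u) ≡ reverse (standardize u)
standardize-reverse u =
  trans (map-cong (λ z → cong suc (↭-length (filter-↭ (_<? z) (↭-reverse u)))) (reverse u))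
        (reverse-map (λ z → suc (length (filter (_<? z) u))) u)

-- Baxter patterns

-- The entries w_i, w_j, w_{j+1}, w_k of a 3-14-2 or a 2-41-3 occurrence.
BaxterPattern : ℕ → ℕ → ℕ → ℕ → Set
BaxterPattern a b c d = (b < d × d < a × a < c) ⊎ (c < a × a < d × d < b)

NoBaxterPattern : List ℕ → Set
NoBaxterPattern u = ∀ i j k → i < j → suc j < k → k < length u →
  ¬ BaxterPattern (at u i) (at u j) (at u (suc j)) (at u k)

NoBaxterPattern⇒Baxter : ∀ u → NoBaxterPattern u → Baxter u
NoBaxterPattern⇒Baxter u h i j k i<j j<k k<u =
  (λ x → h i j k i<j j<k k<u (inj₁ x)) , (λ x → h i j k i<j j<k k<u (inj₂ x))

Baxter⇒NoBaxterPattern : ∀ u → Baxter u → NoBaxterPattern u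
Baxter⇒NoBaxterPattern u h i j k i<j j<k k<u (inj₁ x) = proj₁ (h i j k i<j j<k k<u) x
Baxter⇒NoBaxterPattern u h i j k i<j j<k k<u (inj₂ x) = proj₂ (h i j k i<j j<k k<u) x

BaxterPattern-cong : ∀ {a b c d a′ b′ c′ d′} → a ≡ a′ → b ≡ b′ → c ≡ c′ → d ≡ d′ →
                     BaxterPattern a b c d → BaxterPattern a′ b′ c′ d′
BaxterPattern-cong refl refl refl refl p = p

BaxterPattern-suc : ∀ {a b c d} → BaxterPattern a b c d → BaxterPattern (suc a) (suc b) (suc c) (suc d)
BaxterPattern-suc (inj₁ (x , y , z)) = inj₁ (s≤s x , s≤s y , s≤s z)
BaxterPattern-suc (inj₂ (x , y , z)) = inj₂ (s≤s x , s≤s y , s≤s z)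

BaxterPattern-reverse : ∀ {a b c d} → BaxterPattern a b c d → BaxterPattern d c b a
BaxterPattern-reverse (inj₁ x) = inj₂ x
BaxterPattern-reverse (inj₂ x) = inj₁ x

BaxterPattern-reflect : ∀ f → Monotone f → ∀ {a b c d} →
                        BaxterPattern (f a) (f b) (f c) (f d) → BaxterPattern a b c d
BaxterPattern-reflect f m (inj₁ (x , y , z)) =
  inj₁ (monotone-reflects-< f m x , monotone-reflects-< f m y , monotone-reflects-< f m z)
BaxterPattern-reflect f m (inj₂ (x , y , z)) =
  inj₂ (monotone-reflects-< f m x , monotone-reflects-< f m y , monotone-reflects-< f m z)

NoBaxterPattern-map : ∀ f → Monotone f → ∀ u → NoBaxterPattern u → NoBaxterPattern (map f u)
NoBaxterPattern-map f m u h i j k i<j j<k k<fu pat =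
  h i j k i<j j<k k<u (BaxterPattern-reflect f m (BaxterPattern-cong (at′ i i<u) (at′ j j<u) (at′ (suc j) j+1<u) (at′ k k<u) pat))
  where
  at′ = at-map f u
  k<u = subst (k <_) (length-map f u) k<fu
  j+1<u = <-trans j<k k<u
  j<u = <-trans (n<1+n j) j+1<u
  i<u = <-trans i<j j<u

NoBaxterPattern-reverse : ∀ u → NoBaxterPattern u → NoBaxterPattern (reverse u)
NoBaxterPattern-reverse u B i j k i<j j+1<k k<ru pat =
  B (c k) (c (suc j)) (c i) (c-reverses-< j+1<k k<u) c[j]<c[i] (c-< i<u)
    (BaxterPattern-cong (at-reverse u k k<u) (at-reverse u (suc j) j+1<u)
                        (trans (at-reverse u j j<u) (cong (at u) (c-suc j+1<u))) (at-reverse u i i<u)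
                        (BaxterPattern-reverse pat))
  where
  open Complement (length u)
  k<u = subst (k <_) (length-reverse u) k<ru
  j+1<u = <-trans j+1<k k<u
  j<u = <-trans (n<1+n j) j+1<u
  i<u = <-trans i<j j<u
  c[j]<c[i] = subst (_< c i) (c-suc j+1<u) (c-reverses-< i<j j<u)

Baxter-reverse : ∀ u → Baxter u → Baxter (reverse u)
Baxter-reverse u bax = NoBaxterPattern⇒Baxter (reverse u) (NoBaxterPattern-reverse u (Baxter⇒NoBaxterPattern u bax))

-- The entry x inserted at gap t of u, in each of the four roles w_i, w_j, w_{j+1}, w_k
-- of a pattern occurrence whose other three entries come from u.
record InsertionSafe (t x : ℕ) (u : List ℕ) : Set where
  field
    as-first : ∀ j k → t ≤ j → suc j < k → k < length u →
               ¬ BaxterPattern x (at u j) (at u (suc j)) (at u k)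
    as-left  : ∀ i k → i < t → t < k → k < length u →
               ¬ BaxterPattern (at u i) x (at u t) (at u k)
    as-right : ∀ i k → suc i < t → t ≤ k → k < length u →
               ¬ BaxterPattern (at u i) (at u (pred t)) x (at u k)
    as-last  : ∀ i j → i < j → suc j < t →
               ¬ BaxterPattern (at u i) (at u j) (at u (suc j)) x

open InsertionSafe

data Slot (t : ℕ) : ℕ → Set where
  before : ∀ {y} → y < t → Slot t y
  fresh  : Slot t t
  after  : ∀ {y} → t ≤ y → Slot t (suc y)

slot : ∀ t y → Slot t y
slot t y with <-cmp y t
... | tri< y<t _ _ = before y<t
... | tri≈ _ refl _ = fresh
slot t (suc y) | tri> _ _ (s≤s t≤y) = after t≤y

¬BaxterPattern-transport : ∀ {a b c d a′ b′ c′ d′} → ¬ BaxterPattern a′ b′ c′ d′ →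
                           a ≡ a′ → b ≡ b′ → c ≡ c′ → d ≡ d′ → ¬ BaxterPattern a b c d
¬BaxterPattern-transport ¬pat refl refl refl refl = ¬pat

module _ (t x : ℕ) (u : List ℕ) (t≤u : t ≤ length u) where
  private
    lo : ∀ y → y < t → at (insertAt t x u) y ≡ at u y
    lo y y<t = at-insertAt-< t x u y y<t t≤u
    hi : ∀ y → t ≤ y → at (insertAt t x u) (suc y) ≡ at u y
    hi y t≤y = at-insertAt-> t x u y t≤y t≤u
    mid : at (insertAt t x u) t ≡ x
    mid = at-insertAt-≡ t x u t≤u
    below-length : ∀ {k} → suc k < length (insertAt t x u) → k < length u
    below-length {k} k<xu = ≤-pred (subst (suc k <_) (length-insertAt t x u t≤u) k<xu)

  NoBaxterPattern-insertAt : NoBaxterPattern u → InsertionSafe t x u → NoBaxterPattern (insertAt t x u)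
  NoBaxterPattern-insertAt B S i j k i<j j<k k<xu
    with slot t k | slot t (suc j) | slot t j | slot t i
  ... | before k<t | _ | _ | _ =
    ¬BaxterPattern-transport (B i j k i<j j<k (<-≤-trans k<t t≤u))
      (lo i (<-trans i<j j<t)) (lo j j<t) (lo (suc j) j+1<t) (lo k k<t)
    where
    j+1<t = <-trans j<k k<t
    j<t   = <-trans (n<1+n j) j+1<t
  ... | fresh | _ | _ | _ =
    ¬BaxterPattern-transport (as-last S i j i<j j<k)
      (lo i (<-trans i<j j<t)) (lo j j<t) (lo (suc j) j<k) mid
    where j<t = <-trans (n<1+n j) j<k
  ... | after t≤k | before j+1<t | _ | _ =
    ¬BaxterPattern-transport (B i j _ i<j (<-≤-trans j+1<t t≤k) (below-length k<xu))
      (lo i (<-trans i<j j<t)) (lo j j<t) (lo (suc j) j+1<t) (hi _ t≤k)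
    where j<t = <-trans (n<1+n j) j+1<t
  ... | after t≤k | fresh | _ | _ =
    ¬BaxterPattern-transport (as-right S i _ (s≤s i<j) t≤k (below-length k<xu))
      (lo i (<-trans i<j (n<1+n j))) (lo j (n<1+n j)) mid (hi _ t≤k)
  ... | after _ | after t≤j | before j<t | _ = ⊥-elim (<⇒≱ j<t t≤j)
  ... | after t≤k | after _ | fresh | _ =
    ¬BaxterPattern-transport (as-left S i _ i<j (≤-pred j<k) (below-length k<xu))
      (lo i i<j) mid (hi t ≤-refl) (hi _ t≤k)
  ... | after t≤k | after _ | after t≤j | before i<t =
    ¬BaxterPattern-transport (B i _ _ (<-≤-trans i<t t≤j) (≤-pred j<k) (below-length k<xu))
      (lo i i<t) (hi _ t≤j) (hi _ (m≤n⇒m≤1+n t≤j)) (hi _ t≤k)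
  ... | after t≤k | after _ | after t≤j | fresh =
    ¬BaxterPattern-transport (as-first S _ _ t≤j (≤-pred j<k) (below-length k<xu))
      mid (hi _ t≤j) (hi _ (m≤n⇒m≤1+n t≤j)) (hi _ t≤k)
  ... | after t≤k | after _ | after t≤j | after t≤i =
    ¬BaxterPattern-transport (B _ _ _ (≤-pred i<j) (≤-pred j<k) (below-length k<xu))
      (hi _ t≤i) (hi _ t≤j) (hi _ (m≤n⇒m≤1+n t≤j)) (hi _ t≤k)

NoBaxterPattern-∷ : ∀ x u → NoBaxterPattern u →
                    (∀ j k → suc j < k → k < length u → ¬ BaxterPattern x (at u j) (at u (suc j)) (at u k)) →
                    NoBaxterPattern (x ∷ u)
NoBaxterPattern-∷ x u B first = NoBaxterPattern-insertAt 0 x u z≤n B λ where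
  .as-first j k _ → first j k
  .as-left  _ _ ()
  .as-right _ _ ()
  .as-last  _ _ _ ()

NoBaxterPattern-∷ʳ : ∀ x u → NoBaxterPattern u →
                     (∀ i j → i < j → suc j < length u → ¬ BaxterPattern (at u i) (at u j) (at u (suc j)) x) →
                     NoBaxterPattern (u ++ x ∷ [])
NoBaxterPattern-∷ʳ x u B last =
  subst NoBaxterPattern (insertAt-length x u) (NoBaxterPattern-insertAt (length u) x u ≤-refl B λ where
    .as-first j k u≤j j<k k<u → ⊥-elim (<⇒≱ (<-trans (n<1+n j) (<-trans j<k k<u)) u≤j)
    .as-left  _ k _ u<k k<u   → ⊥-elim (<-asym u<k k<u)
    .as-right _ k _ u≤k k<u   → ⊥-elim (<⇒≱ k<u u≤k)
    .as-last                  → last)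

-- Permutations fixed under rotation

upcrossing : ∀ (v : ℕ → ℕ) s e t → s ≤ e → v s ≤ t → t < v e →
             ∃[ r ] (s ≤ r × r < e × v r ≤ t × t < v (suc r))
upcrossing v s zero    t z≤n vs≤t t<ve = ⊥-elim (<-irrefl refl (≤-<-trans vs≤t t<ve))
upcrossing v s (suc e) t s≤e+1 vs≤t t<ve with m≤n⇒m<n∨m≡n s≤e+1 | t <? v e
... | inj₂ refl    | _ = ⊥-elim (<-irrefl refl (≤-<-trans vs≤t t<ve))
... | inj₁ (s≤s s≤e) | yes t<ve′ =
  let r , s≤r , r<e , rest = upcrossing v s e t s≤e vs≤t t<ve′ in r , s≤r , m≤n⇒m≤1+n r<e , rest
... | inj₁ (s≤s s≤e) | no  t≮ve′ = e , s≤e , ≤-refl , ≮⇒≥ t≮ve′ , t<ve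

downcrossing : ∀ (v : ℕ → ℕ) s e t → s ≤ e → t < v s → v e ≤ t →
               ∃[ r ] (s ≤ r × r < e × t < v r × v (suc r) ≤ t)
downcrossing v s zero    t z≤n t<vs ve≤t = ⊥-elim (<-irrefl refl (<-≤-trans t<vs ve≤t))
downcrossing v s (suc e) t s≤e+1 t<vs ve≤t with m≤n⇒m<n∨m≡n s≤e+1 | v e ≤? t
... | inj₂ refl    | _ = ⊥-elim (<-irrefl refl (<-≤-trans t<vs ve≤t))
... | inj₁ (s≤s s≤e) | yes ve′≤t =
  let r , s≤r , r<e , rest = downcrossing v s e t s≤e t<vs ve′≤t in r , s≤r , m≤n⇒m≤1+n r<e , rest
... | inj₁ (s≤s s≤e) | no  ve′≰t = e , s≤e , ≤-refl , ≰⇒> ve′≰t , ve≤t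

NoBaxterPatternOn : ℕ → (ℕ → ℕ) → Set
NoBaxterPatternOn n v = ∀ i j k → i < j → suc j < k → k < n → ¬ BaxterPattern (v i) (v j) (v (suc j)) (v k)

module OneLine (N : ℕ) (w : List ℕ) (w↭ : IsPerm N w) where

  length-w : length w ≡ N
  length-w = trans (↭-length w↭) (length-applyUpTo suc N)

  v : ℕ → ℕ
  v i = pred (at w i)

  entry : ∀ i → i < N → ∃[ z ] (z < N × at w i ≡ suc z)
  entry i i<N = ∈-applyUpTo⁻ suc (∈-resp-↭ w↭ (at-∈ w i (subst (i <_) (sym length-w) i<N)))

  at-w : ∀ i → i < N → at w i ≡ suc (v i)
  at-w i i<N with entry i i<N
  ... | _ , _ , e = trans e (cong (λ x → suc (pred x)) (sym e))

  v-< : ∀ i → i < N → v i < N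
  v-< i i<N with entry i i<N
  ... | _ , z<N , e = subst (_< N) (cong pred (sym e)) z<N

  v∘v : RotFixed w → ∀ i → i < N → v (v i) ≡ complement N i
  v∘v rot i i<N = trans (cong pred w[w[i]]) (pred[m∸n]≡m∸[1+n] N i)
    where
    w[w[i]] : at w (v i) ≡ N ∸ i
    w[w[i]] = trans (cong (λ x → at w (x ∸ 1)) (sym (at-w i i<N)))
                    (trans (rot i (subst (i <_) (sym length-w) i<N)) (cong (_∸ i) length-w))

  v-baxter : Baxter w → NoBaxterPatternOn N v
  v-baxter bax i j k i<j j+1<k k<N pat =
    Baxter⇒NoBaxterPattern w bax i j k i<j j+1<k (subst (k <_) (sym length-w) k<N)
      (BaxterPattern-cong (sym (at-w i (<-trans i<j j<N))) (sym (at-w j j<N)) (sym (at-w (suc j) j+1<N))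
                          (sym (at-w k k<N)) (BaxterPattern-suc pat))
    where
    j+1<N = <-trans j+1<k k<N
    j<N = <-trans (n<1+n j) j+1<N

  module _ (p : ℕ) (p<N : p < N) (bax+ : Baxter (insertAt p (suc N) w)) where
    private
      w+ = insertAt p (suc N) w
      p≤w = subst (p ≤_) (sym length-w) (<⇒≤ p<N)
      length-w+ : length w+ ≡ suc N
      length-w+ = trans (length-insertAt p (suc N) w p≤w) (cong suc length-w)
      at-w+-< : ∀ i → i < p → at w+ i ≡ suc (v i)
      at-w+-< i i<p = trans (at-insertAt-< p (suc N) w i i<p p≤w) (at-w i (<-trans i<p p<N))
      at-w+-> : ∀ k → p ≤ k → k < N → at w+ (suc k) ≡ suc (v k)
      at-w+-> k p≤k k<N = trans (at-insertAt-> p (suc N) w k p≤k p≤w) (at-w k k<N)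

    no-2413-with-max : ∀ i k → i < p → p < k → k < N → ¬ (v p < v i × v i < v k)
    no-2413-with-max i k i<p p<k k<N (p<i , i<k) =
      Baxter⇒NoBaxterPattern w+ bax+ i p (suc k) i<p (s≤s p<k) (subst (suc k <_) (sym length-w+) (s≤s k<N))
        (BaxterPattern-cong (sym (at-w+-< i i<p)) (sym (at-insertAt-≡ p (suc N) w p≤w))
                            (sym (at-w+-> p ≤-refl p<N)) (sym (at-w+-> k (<⇒≤ p<k) k<N))
                            (inj₂ (s≤s p<i , s≤s i<k , s≤s (v-< k k<N))))

    no-3142-with-max : ∀ p′ → p ≡ suc p′ → ∀ i k → i < p′ → p ≤ k → k < N → ¬ (v p′ < v k × v k < v i)
    no-3142-with-max p′ refl i k i<p′ p≤k k<N (p′<k , k<i) =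
      Baxter⇒NoBaxterPattern w+ bax+ i p′ (suc k) i<p′ (s≤s p≤k) (subst (suc k <_) (sym length-w+) (s≤s k<N))
        (BaxterPattern-cong (sym (at-w+-< i (<-trans i<p′ (n<1+n p′)))) (sym (at-w+-< p′ (n<1+n p′)))
                            (sym (at-insertAt-≡ p (suc N) w p≤w)) (sym (at-w+-> k p≤k k<N))
                            (inj₁ (s≤s p′<k , s≤s k<i , s≤s (v-< i (<-trans (<-trans i<p′ (n<1+n p′)) p<N)))))

module RotationFixed (n : ℕ) (v : ℕ → ℕ) (v-< : ∀ i → i < n → v i < n)
                     (v∘v : ∀ i → i < n → v (v i) ≡ complement n i) where
  open Complement n

  v-injective : ∀ {x y} → x < n → y < n → v x ≡ v y → x ≡ y
  v-injective {x} {y} x<n y<n vx≡vy = begin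
    x           ≡⟨ c-involutive x<n ⟨
    c (c x)     ≡⟨ cong c (v∘v x x<n) ⟨
    c (v (v x)) ≡⟨ cong (λ z → c (v z)) vx≡vy ⟩
    c (v (v y)) ≡⟨ cong c (v∘v y y<n) ⟩
    c (c y)     ≡⟨ c-involutive y<n ⟩
    y           ∎
    where open ≡-Reasoning

  v-≢ : ∀ {x y} → x < n → y < n → x ≢ y → v x ≢ v y
  v-≢ x<n y<n x≢y vx≡vy = x≢y (v-injective x<n y<n vx≡vy)

  v-c : ∀ {x} → x < n → v (c x) ≡ c (v x)
  v-c {x} x<n = trans (cong v (sym (v∘v x x<n))) (v∘v (v x) (v-< x x<n))

  v-c-v : ∀ {x} → x < n → v (c (v x)) ≡ x
  v-c-v {x} x<n = trans (v-c (v-< x x<n)) (trans (cong c (v∘v x x<n)) (c-involutive x<n))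

  v∘v-suc : ∀ q → suc q < n → v (v q) ≡ suc (v (v (suc q)))
  v∘v-suc q q+1<n =
    trans (v∘v q (<-trans (n<1+n q) q+1<n)) (trans (c-suc q+1<n) (cong suc (sym (v∘v (suc q) q+1<n))))

  v∘v-reverses-< : ∀ {x y} → x < y → y < n → v (v y) < v (v x)
  v∘v-reverses-< {x} {y} x<y y<n =
    subst₂ _<_ (sym (v∘v y y<n)) (sym (v∘v x (<-trans x<y y<n))) (c-reverses-< x<y y<n)

RotFixed-reverse : ∀ N w → IsPerm N w → RotFixed w → RotFixed (reverse w)
RotFixed-reverse N w w↭ rot i i<rw = begin
  at (reverse w) (at (reverse w) i ∸ 1)  ≡⟨ cong (λ x → at (reverse w) (x ∸ 1)) (trans (at-rw i i<N) (at-w (c i) (c-< i<N))) ⟩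
  at (reverse w) (v (c i))               ≡⟨ at-rw (v (c i)) (v-< (c i) (c-< i<N)) ⟩
  at w (c (v (c i)))                     ≡⟨ at-w (c (v (c i))) (c-< (v-< (c i) (c-< i<N))) ⟩
  suc (v (c (v (c i))))                  ≡⟨ cong suc (v-c-v (c-< i<N)) ⟩
  suc (c i)                              ≡⟨ m∸n≡1+m∸[1+n] N i i<N ⟨
  N ∸ i                                  ≡⟨ cong (_∸ i) (trans (length-reverse w) length-w) ⟨
  length (reverse w) ∸ i                 ∎
  where
  open ≡-Reasoning
  open OneLine N w w↭
  open Complement N
  open RotationFixed N v v-< (v∘v rot)
  i<N = subst (i <_) (trans (length-reverse w) length-w) i<rw
  at-rw : ∀ x → x < N → at (reverse w) x ≡ at w (c x)
  at-rw x x<N = trans (at-reverse w x (subst (x <_) (sym length-w) x<N)) (cong (λ t → at w (t ∸ suc x)) length-w)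

-- The extension

RotationFixedExtension : ℕ → List ℕ → ℕ → Set
RotationFixedExtension n w p =
  ∃[ w′ ] (IsPerm (n + 4) w′ × Baxter w′ × RotFixed w′ ×
    ∃[ a ] ∃[ b ] ∃[ m ] ∃[ u ]
      (w′ ≡ a ∷ (m ++ b ∷ []) × 1 ∈ m × removeOne m ≡ insertAt p (n + 4) u × standardize u ≡ w))

module RotationFixedBaxter (n : ℕ) (v : ℕ → ℕ) (v-< : ∀ i → i < n → v i < n)
                           (v∘v : ∀ i → i < n → v (v i) ≡ complement n i)
                           (v-baxter : NoBaxterPatternOn n v) where
  open Complement n
  open RotationFixed n v v-< v∘v

  -- Two positions α < γ holding consecutive values cannot be separated by a segment crossing
  -- that value gap: its crossing step would complete a 3-14-2 (resp. 2-41-3) with α and γ.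
  no-upcrossing-between : ∀ α s e γ → α < s → s ≤ e → e < γ → γ < n →
                          v s ≤ v γ → v γ < v e → v α ≡ suc (v γ) → ⊥
  no-upcrossing-between α s e γ α<s s≤e e<γ γ<n vs≤vγ vγ<ve vα≡
    with upcrossing v s e (v γ) s≤e vs≤vγ vγ<ve
  ... | r , s≤r , r<e , vr≤vγ , vγ<vr+1 =
    v-baxter α r γ α<r (≤-<-trans r<e e<γ) γ<n (inj₁ (vr<vγ , subst (v γ <_) (sym vα≡) ≤-refl , vα<vr+1))
    where
    α<r = <-≤-trans α<s s≤r
    r<γ = <-trans r<e e<γ
    vr<vγ = ≤∧≢⇒< vr≤vγ (v-≢ (<-trans r<γ γ<n) γ<n (<⇒≢ r<γ))
    vα<vr+1 = subst (_< v (suc r)) (sym vα≡)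
      (≤∧≢⇒< vγ<vr+1 (λ e → v-≢ (<-trans α<r (<-trans r<γ γ<n)) (<-trans (≤-<-trans r<e e<γ) γ<n)
                                 (<⇒≢ (<-trans α<r (n<1+n r))) (trans vα≡ e)))

  no-downcrossing-between : ∀ α s e γ → α < s → s ≤ e → e < γ → γ < n →
                            v α < v s → v e ≤ v α → v γ ≡ suc (v α) → ⊥
  no-downcrossing-between α s e γ α<s s≤e e<γ γ<n vα<vs ve≤vα vγ≡
    with downcrossing v s e (v α) s≤e vα<vs ve≤vα
  ... | r , s≤r , r<e , vα<vr , vr+1≤vα =
    v-baxter α r γ α<r (≤-<-trans r<e e<γ) γ<n (inj₂ (vr+1<vα , subst (v α <_) (sym vγ≡) ≤-refl , vγ<vr))
    where
    α<r = <-≤-trans α<s s≤r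
    r<γ = <-trans r<e e<γ
    vr+1<vα = ≤∧≢⇒< vr+1≤vα (v-≢ (<-trans (≤-<-trans r<e e<γ) γ<n) (<-trans α<r (<-trans r<γ γ<n))
                              (≢-sym (<⇒≢ (<-trans α<r (n<1+n r)))))
    vγ<vr = subst (_< v r) (sym vγ≡)
      (≤∧≢⇒< vα<vr (λ e → v-≢ γ<n (<-trans r<γ γ<n) (≢-sym (<⇒≢ r<γ)) (trans vγ≡ e)))

  n-odd : ∀ h → n ≢ suc h + suc h
  n-odd h n≡ = middle (<-cmp x h)
    where
    h+1<n : suc h < n
    h+1<n = subst (suc h <_) (sym n≡) (s≤s (m≤n+m (suc h) h))
    h<n = <-trans (n<1+n h) h+1<n
    c-h : c h ≡ suc h
    c-h = trans (cong (_∸ suc h) n≡) (m+n∸n≡m (suc h) (suc h))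
    x = v h
    x<n = v-< h h<n
    vx : v x ≡ suc h
    vx = trans (v∘v h h<n) c-h
    v[h+1] : v (suc h) ≡ c x
    v[h+1] = trans (cong v (sym c-h)) (v-c h<n)
    v[cx] : v (c x) ≡ h
    v[cx] = v-c-v h<n
    middle : Tri (x < h) (x ≡ h) (h < x) → ⊥
    middle (tri< x<h _ _) =
      v-baxter x h (c x) x<h h+1<cx (c-< x<n)
        (BaxterPattern-cong (sym vx) refl (sym v[h+1]) (sym v[cx]) (inj₁ (x<h , n<1+n h , h+1<cx)))
      where h+1<cx = subst (_< c x) c-h (c-reverses-< x<h h<n)
    middle (tri≈ _ x≡h _) = <⇒≢ (n<1+n h) (trans (sym (trans (cong v x≡h) x≡h)) vx)
    middle (tri> _ _ h<x) with m≤n⇒m<n∨m≡n h<x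
    ... | inj₂ h+1≡x = <⇒≢ (n<1+n h) (begin
      h           ≡⟨ c-involutive h<n ⟨
      c (c h)     ≡⟨ cong c (trans c-h h+1≡x) ⟩
      c x         ≡⟨ v[h+1] ⟨
      v (suc h)   ≡⟨ cong v h+1≡x ⟩
      v x         ≡⟨ vx ⟩
      suc h       ∎)
      where open ≡-Reasoning
    ... | inj₁ h+1<x =
      v-baxter (c x) h x cx<h h+1<x x<n
        (BaxterPattern-cong (sym v[cx]) refl (sym v[h+1]) (sym vx) (inj₂ (cx<h , n<1+n h , h+1<x)))
      where cx<h = subst (c x <_) (trans (cong c (sym c-h)) (c-involutive h<n)) (c-reverses-< h+1<x x<n)

  -- The gap p ≤ K := c p receives the new maximum; the new minimum goes to the mirror gap, right after K.
  module Gap (p : ℕ) (p<n : p < n) (p≤K : p ≤ c p)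
    (no-3142-max : ∀ p′ → p ≡ suc p′ → ∀ i k → i < p′ → p ≤ k → k < n → ¬ (v p′ < v k × v k < v i))
    (no-2413-max : ∀ i k → i < p → p < k → k < n → ¬ (v p < v i × v i < v k)) where

    K : ℕ
    K = c p

    K<n : K < n
    K<n = c-< p<n

    c-K : c K ≡ p
    c-K = c-involutive p<n

    c-p′ : ∀ p′ → p ≡ suc p′ → c p′ ≡ suc K
    c-p′ p′ refl = c-suc p<n

    p′<p : ∀ p′ → p ≡ suc p′ → p′ < p
    p′<p p′ refl = n<1+n p′

    K<⇒0<p : ∀ {x} → x < n → K < x → 0 < p
    K<⇒0<p {x} x<n K<x = n≢0⇒n>0 λ p≡0 →
      <⇒≱ K<x (subst (x ≤_) (cong c (sym p≡0)) (subst (_≤ c 0) (c-involutive x<n) (c-reverses-≤ z≤n)))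

    p≤v[p] : p ≤ v p
    p≤v[p] with p ≤? v p
    ... | yes p≤d = p≤d
    ... | no  p≰d = ⊥-elim (refute (m≤n⇒m<n∨m≡n p≤K))
      where
      d = v p
      d<p = ≰⇒> p≰d
      v[d] : v d ≡ K
      v[d] = v∘v p p<n
      v[K] : v K ≡ c d
      v[K] = v-c p<n
      K<c[d] : K < c d
      K<c[d] = c-reverses-< d<p p<n
      refute : p < K ⊎ p ≡ K → ⊥
      refute (inj₁ p<K) =
        no-2413-max d K d<p p<K K<n (subst (d <_) (sym v[d]) (<-≤-trans d<p p≤K) , subst₂ _<_ (sym v[d]) (sym v[K]) K<c[d])
      refute (inj₂ p≡K) = <-irrefl d≡c[d] (<-trans (<-≤-trans d<p p≤K) K<c[d])
        where d≡c[d] = trans (cong v p≡K) v[K]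

    p≤v[p′] : ∀ p′ → p ≡ suc p′ → p ≤ v p′
    p≤v[p′] p′ p≡ with p ≤? v p′
    ... | yes p≤e = p≤e
    ... | no  p≰e = ⊥-elim (refute (m≤n⇒m<n∨m≡n (≤-pred (subst (e <_) p≡ (≰⇒> p≰e)))))
      where
      e = v p′
      p′<n = <-trans (p′<p p′ p≡) p<n
      v[e] : v e ≡ suc K
      v[e] = trans (v∘v p′ p′<n) (c-p′ p′ p≡)
      p′<K+1 = <-≤-trans (p′<p p′ p≡) (m≤n⇒m≤1+n p≤K)
      refute : e < p′ ⊎ e ≡ p′ → ⊥
      refute (inj₁ e<p′) =
        no-3142-max p′ p≡ e (c e) e<p′ p≤c[e] (c-< (v-< p′ p′<n))
          (subst (e <_) (sym (v-c-v p′<n)) e<p′ , subst₂ _<_ (sym (v-c-v p′<n)) (sym v[e]) p′<K+1)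
        where
        p≤c[e] = ≤-trans p≤K (≤-trans (n≤1+n K) (<⇒≤ (subst (_< c e) (c-p′ p′ p≡) (c-reverses-< e<p′ p′<n))))
      refute (inj₂ e≡p′) = <-irrefl (sym (trans (sym v[e]) (trans (cong v e≡p′) e≡p′))) p′<K+1

    v[K]≤K : v K ≤ K
    v[K]≤K = subst (_≤ K) (sym (v-c p<n)) (c-reverses-≤ p≤v[p])

    v[K+1]≤K : ∀ p′ → p ≡ suc p′ → v (suc K) ≤ K
    v[K+1]≤K p′ p≡ =
      subst (_≤ K) (trans (sym (v-c (<-trans (p′<p p′ p≡) p<n))) (cong v (c-p′ p′ p≡))) (c-reverses-≤ (p≤v[p′] p′ p≡))

    -- The mirror images under rotation of the two hypotheses on the maximum.
    no-2413-min : ∀ i k → i < K → K < k → k < n → ¬ (v i < v k × v k < v K)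
    no-2413-min i k i<K K<k k<n (i<k , k<K) = no-2413-max (c k) (c i) c[k]<p p<c[i] (c-< i<n) (p<ck , ck<ci)
      where
      i<n = <-trans i<K K<n
      c[k]<p = subst (c k <_) c-K (c-reverses-< K<k k<n)
      p<c[i] = subst (_< c i) c-K (c-reverses-< i<K K<n)
      p<ck = subst₂ _<_ (trans (sym (v-c K<n)) (cong v c-K)) (sym (v-c k<n)) (c-reverses-< k<K (v-< K K<n))
      ck<ci = subst₂ _<_ (sym (v-c k<n)) (sym (v-c i<n)) (c-reverses-< i<k (v-< k k<n))

    no-3142-min : ∀ p′ → p ≡ suc p′ → ∀ i k → i < suc K → suc K < k → k < n → ¬ (v k < v i × v i < v (suc K))
    no-3142-min p′ p≡ i k i<K+1 K+1<k k<n (k<i , i<K+1′) =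
      no-3142-max p′ p≡ (c k) (c i) c[k]<p′ p≤c[i] (c-< i<n) (p′<ci , ci<ck)
      where
      K+1<n = <-trans K+1<k k<n
      i<n = <-trans i<K+1 K+1<n
      c[K+1] : c (suc K) ≡ p′
      c[K+1] = trans (cong c (sym (c-p′ p′ p≡))) (c-involutive (<-trans (p′<p p′ p≡) p<n))
      c[k]<p′ = subst (c k <_) c[K+1] (c-reverses-< K+1<k k<n)
      p≤c[i] = subst (_≤ c i) (sym p≡) (subst (_< c i) c[K+1] (c-reverses-< i<K+1 K+1<n))
      p′<ci = subst₂ _<_ (trans (sym (v-c K+1<n)) (cong v c[K+1])) (sym (v-c i<n)) (c-reverses-< i<K+1′ (v-< (suc K) K+1<n))
      ci<ck = subst₂ _<_ (sym (v-c i<n)) (sym (v-c k<n)) (c-reverses-< k<i (v-< i i<n))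

    -- In each of the following, α and γ are v q and v (q + 1) in some order, the pair of positions
    -- with consecutive values that the rotation attaches to the adjacent positions q, q + 1.
    no-3142-first : ∀ q k → suc q < k → k < n → v q < v k → v k < p → p ≤ v (suc q) → ⊥
    no-3142-first q k q+1<k k<n vq<vk vk<p p≤γ with positive⇒suc (≤-<-trans z≤n vk<p)
    ... | p′ , p≡ = compare (<-cmp (v p′) (v γ))
      where
      α = v q
      γ = v (suc q)
      q+1<n = <-trans q+1<k k<n
      γ<n = v-< (suc q) q+1<n
      vk≤p′ = ≤-pred (subst (v k <_) p≡ vk<p)
      p′<γ = <-≤-trans (p′<p p′ p≡) p≤γ
      v[α]≡ = v∘v-suc q q+1<n
      vγ<vα = subst (v γ <_) (sym v[α]≡) (n<1+n (v γ))
      compare : Tri (v p′ < v γ) (v p′ ≡ v γ) (v γ < v p′) → ⊥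
      compare (tri< vp′<vγ _ _) = no-3142-max p′ p≡ α γ (<-≤-trans vq<vk vk≤p′) p≤γ γ<n (vp′<vγ , vγ<vα)
      compare (tri≈ _ vp′≡vγ _) = v-≢ (<-trans (p′<p p′ p≡) p<n) γ<n (<⇒≢ p′<γ) vp′≡vγ
      compare (tri> _ _ vγ<vp′) =
        no-upcrossing-between α (v k) p′ γ vq<vk vk≤p′ p′<γ γ<n (<⇒≤ (v∘v-reverses-< q+1<k k<n)) vγ<vp′ v[α]≡

    no-2413-first : ∀ q k → suc q < k → k < n → v (suc q) < p → p ≤ v k → v k < v q → ⊥
    no-2413-first q k q+1<k k<n α<p p≤vk vk<γ = compare (<-cmp (v p) (v α))
      where
      α = v (suc q)
      γ = v q
      q+1<n = <-trans q+1<k k<n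
      v[γ]≡ = v∘v-suc q q+1<n
      vα<vγ = subst (v α <_) (sym v[γ]≡) (n<1+n (v α))
      compare : Tri (v p < v α) (v p ≡ v α) (v α < v p) → ⊥
      compare (tri< vp<vα _ _) =
        no-2413-max α γ α<p (≤-<-trans p≤vk vk<γ) (v-< q (<-trans (n<1+n q) q+1<n)) (vp<vα , vα<vγ)
      compare (tri≈ _ vp≡vα _) = v-≢ p<n (v-< (suc q) q+1<n) (≢-sym (<⇒≢ α<p)) vp≡vα
      compare (tri> _ _ vα<vp) =
        no-downcrossing-between α p (v k) γ α<p p≤vk vk<γ (v-< q (<-trans (n<1+n q) q+1<n)) vα<vp
          (<⇒≤ (v∘v-reverses-< q+1<k k<n)) v[γ]≡

    no-3142-last : ∀ i q → i < q → suc q < n → v q ≤ K → K < v i → v i < v (suc q) → ⊥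
    no-3142-last i q i<q q+1<n α≤K K<vi vi<γ with positive⇒suc (K<⇒0<p (v-< i (<-trans i<q q<n)) K<vi)
      where q<n = <-trans (n<1+n q) q+1<n
    ... | p′ , p≡ = compare (<-cmp (v (suc K)) (v α))
      where
      α = v q
      γ = v (suc q)
      q<n = <-trans (n<1+n q) q+1<n
      v[α]≡ = v∘v-suc q q+1<n
      vγ<vα = subst (v γ <_) (sym v[α]≡) (n<1+n (v γ))
      vα<v[vi] = v∘v-reverses-< i<q q<n
      compare : Tri (v (suc K) < v α) (v (suc K) ≡ v α) (v α < v (suc K)) → ⊥
      compare (tri< vK+1<vα _ _) =
        no-upcrossing-between α (suc K) (v i) γ (s≤s α≤K) K<vi vi<γ (v-< (suc q) q+1<n)
          (≤-pred (subst (v (suc K) <_) v[α]≡ vK+1<vα)) (<-trans vγ<vα vα<v[vi]) v[α]≡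
      compare (tri≈ _ vK+1≡vα _) =
        v-≢ (≤-<-trans K<vi (v-< i (<-trans i<q q<n))) (v-< q q<n) (≢-sym (<⇒≢ (s≤s α≤K))) vK+1≡vα
      compare (tri> _ _ vα<vK+1) =
        no-3142-min p′ p≡ α γ (s≤s α≤K) (≤-<-trans K<vi vi<γ) (v-< (suc q) q+1<n) (vγ<vα , vα<vK+1)

    no-2413-last : ∀ i q → i < q → suc q < n → v (suc q) < v i → v i ≤ K → K < v q → ⊥
    no-2413-last i q i<q q+1<n α<vi vi≤K K<γ = compare (<-cmp (v K) (v γ))
      where
      α = v (suc q)
      γ = v q
      q<n = <-trans (n<1+n q) q+1<n
      v[γ]≡ = v∘v-suc q q+1<n
      vα<vγ = subst (v α <_) (sym v[γ]≡) (n<1+n (v α))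
      vγ<v[vi] = v∘v-reverses-< i<q q<n
      compare : Tri (v K < v γ) (v K ≡ v γ) (v γ < v K) → ⊥
      compare (tri< vK<vγ _ _) =
        no-downcrossing-between α (v i) K γ α<vi vi≤K K<γ (v-< q q<n) (<-trans vα<vγ vγ<v[vi])
          (≤-pred (subst (v K <_) v[γ]≡ vK<vγ)) v[γ]≡
      compare (tri≈ _ vK≡vγ _) = v-≢ K<n (v-< q q<n) (<⇒≢ K<γ) vK≡vγ
      compare (tri> _ _ vγ<vK) = no-2413-min α γ (<-≤-trans α<vi vi≤K) K<γ (v-< q q<n) (vα<vγ , vγ<vK)

    no-2413-first-last : ∀ q → suc q < n → v (suc q) < p → K < v q → ⊥
    no-2413-first-last q q+1<n α<p K<γ = compare-p (<-cmp (v p) (v α))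
      where
      α = v (suc q)
      γ = v q
      γ<n = v-< q (<-trans (n<1+n q) q+1<n)
      v[γ]≡ = v∘v-suc q q+1<n
      vα<vγ = subst (v α <_) (sym v[γ]≡) (n<1+n (v α))
      compare-K : v α < v p → Tri (v K < v γ) (v K ≡ v γ) (v γ < v K) → ⊥
      compare-K vα<vp (tri< vK<vγ _ _) =
        no-downcrossing-between α p K γ α<p p≤K K<γ γ<n vα<vp (≤-pred (subst (v K <_) v[γ]≡ vK<vγ)) v[γ]≡
      compare-K _ (tri≈ _ vK≡vγ _) = v-≢ K<n γ<n (<⇒≢ K<γ) vK≡vγ
      compare-K _ (tri> _ _ vγ<vK) = no-2413-min α γ (<-≤-trans α<p p≤K) K<γ γ<n (vα<vγ , vγ<vK)
      compare-p : Tri (v p < v α) (v p ≡ v α) (v α < v p) → ⊥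
      compare-p (tri< vp<vα _ _) = no-2413-max α γ α<p (≤-<-trans p≤K K<γ) γ<n (vp<vα , vα<vγ)
      compare-p (tri≈ _ vp≡vα _) = v-≢ p<n (v-< (suc q) q+1<n) (≢-sym (<⇒≢ α<p)) vp≡vα
      compare-p (tri> _ _ vα<vp) = compare-K vα<vp (<-cmp (v K) (v γ))

    no-3142-max-last : ∀ p′ → p ≡ suc p′ → ∀ i → i < p′ → K < v i → v p′ ≤ K → ⊥
    no-3142-max-last p′ p≡ i i<p′ K<vi e≤K =
      no-3142-max p′ p≡ i e i<p′ p≤e (v-< p′ p′<n) (subst (v p′ <_) (sym v[e]) (s≤s e≤K) , ve<vi)
      where
      e = v p′
      p′<n = <-trans (p′<p p′ p≡) p<n
      p≤e = p≤v[p′] p′ p≡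
      v[e] : v e ≡ suc K
      v[e] = trans (v∘v p′ p′<n) (c-p′ p′ p≡)
      i<e = <-trans i<p′ (<-≤-trans (p′<p p′ p≡) p≤e)
      ve<vi = subst (_< v i) (sym v[e])
        (≤∧≢⇒< K<vi (λ K+1≡vi → <⇒≢ i<e (v-injective (<-trans i<p′ p′<n) (v-< p′ p′<n) (trans (sym K+1≡vi) (sym v[e])))))

    no-2413-max-last : ∀ i → i < p → v p < v i → v i ≤ K → ⊥
    no-2413-max-last i i<p vp<vi vi≤K with m≤n⇒m<n∨m≡n p≤v[p]
    ... | inj₂ p≡d = <⇒≱ vp<vi (subst (v i ≤_) (trans (sym (v∘v p p<n)) (cong v (sym p≡d))) vi≤K)
    ... | inj₁ p<d = no-2413-max i (v p) i<p p<d (v-< p p<n) (vp<vi , vi<vd)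
      where
      v[d] : v (v p) ≡ K
      v[d] = v∘v p p<n
      vi<vd = subst (v i <_) (sym v[d])
        (≤∧≢⇒< vi≤K (λ vi≡K → <⇒≢ (<-trans i<p p<d) (v-injective (<-trans i<p p<n) (v-< p p<n) (trans vi≡K (sym v[d])))))

    no-2413-first-min : ∀ k → K < k → k < n → p ≤ v k → v k < v K → ⊥
    no-2413-first-min k K<k k<n p≤vk vk<vK with m≤n⇒m<n∨m≡n v[K]≤K
    ... | inj₂ d≡K = <⇒≱ vk<vK (subst (_≤ v k) (trans (sym v[d]) (cong v d≡K)) p≤vk)
      where
      v[d] : v (v K) ≡ p
      v[d] = trans (v∘v K K<n) c-K
    ... | inj₁ d<K = no-2413-min (v K) k d<K K<k k<n (vd<vk , vk<vK)
      where
      v[d] : v (v K) ≡ p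
      v[d] = trans (v∘v K K<n) c-K
      vd<vk = subst (_< v k) (sym v[d])
        (≤∧≢⇒< p≤vk (λ p≡vk → <⇒≢ (<-trans d<K K<k) (v-injective (v-< K K<n) k<n (trans v[d] p≡vk))))

    no-3142-first-min : ∀ p′ → p ≡ suc p′ → ∀ k → suc K < k → k < n → v k < p → p ≤ v (suc K) → ⊥
    no-3142-first-min p′ p≡ k K+1<k k<n vk<p p≤vK+1 =
      no-3142-min p′ p≡ d k (s≤s (v[K+1]≤K p′ p≡)) K+1<k k<n (vk<vd , subst (_< v (suc K)) (sym v[d]) (<-≤-trans (p′<p p′ p≡) p≤vK+1))
      where
      K+1<n = <-trans K+1<k k<n
      d = v (suc K)
      v[d] : v d ≡ p′
      v[d] = trans (v∘v (suc K) K+1<n) (trans (cong c (sym (c-p′ p′ p≡))) (c-involutive (<-trans (p′<p p′ p≡) p<n)))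
      d<k = <-trans (s≤s (v[K+1]≤K p′ p≡)) K+1<k
      vk<vd = subst (v k <_) (sym v[d])
        (≤∧≢⇒< (≤-pred (subst (v k <_) p≡ vk<p)) (λ vk≡p′ → <⇒≢ d<k (sym (v-injective k<n (v-< (suc K) K+1<n) (trans vk≡p′ (sym v[d]))))))

    -- The position of the old entry at y once the new maximum sits at p and the new minimum after K.
    shift : ℕ → ℕ
    shift y with y <? p | y ≤? K
    ... | yes _ | _     = y
    ... | no  _ | yes _ = suc y
    ... | no  _ | no  _ = suc (suc y)

    data ShiftView (y z : ℕ) : Set where
      low  : y < p → z ≡ y → ShiftView y z
      mid  : p ≤ y → y ≤ K → z ≡ suc y → ShiftView y z
      high : K < y → z ≡ suc (suc y) → ShiftView y z

    shift-view : ∀ y → ShiftView y (shift y)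
    shift-view y with y <? p | y ≤? K
    ... | yes y<p | _       = low y<p refl
    ... | no  y≮p | yes y≤K = mid (≮⇒≥ y≮p) y≤K refl
    ... | no  _   | no  y≰K = high (≰⇒> y≰K) refl

    shift-low : ∀ {y} → y < p → shift y ≡ y
    shift-low {y} y<p with shift-view y
    ... | low _ e      = e
    ... | mid p≤y _ _  = ⊥-elim (<⇒≱ y<p p≤y)
    ... | high K<y _   = ⊥-elim (<-irrefl refl (<-trans y<p (≤-<-trans p≤K K<y)))

    shift-mid : ∀ {y} → p ≤ y → y ≤ K → shift y ≡ suc y
    shift-mid {y} p≤y y≤K with shift-view y
    ... | low y<p _    = ⊥-elim (<⇒≱ y<p p≤y)
    ... | mid _ _ e    = e
    ... | high K<y _   = ⊥-elim (<⇒≱ K<y y≤K)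

    shift-high : ∀ {y} → K < y → shift y ≡ suc (suc y)
    shift-high {y} K<y with shift-view y
    ... | low y<p _    = ⊥-elim (<-irrefl refl (<-trans y<p (≤-<-trans p≤K K<y)))
    ... | mid _ y≤K _  = ⊥-elim (<⇒≱ K<y y≤K)
    ... | high _ e     = e

    shift-mono-< : ∀ {y y′} → y < y′ → shift y < shift y′
    shift-mono-< {y} {y′} y<y′ with shift-view y | shift-view y′
    ... | low _ e     | low _ e′     rewrite e | e′ = y<y′
    ... | low _ e     | mid _ _ e′   rewrite e | e′ = m≤n⇒m≤1+n y<y′
    ... | low _ e     | high _ e′    rewrite e | e′ = m≤n⇒m≤1+n (m≤n⇒m≤1+n y<y′)
    ... | mid p≤y _ _ | low y′<p _   = ⊥-elim (<⇒≱ (<-trans y<y′ y′<p) p≤y)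
    ... | mid _ _ e   | mid _ _ e′   rewrite e | e′ = s≤s y<y′
    ... | mid _ _ e   | high _ e′    rewrite e | e′ = s≤s (m≤n⇒m≤1+n y<y′)
    ... | high K<y _  | low y′<p _   = ⊥-elim (<-irrefl refl (<-trans (<-trans K<y y<y′) (<-≤-trans y′<p p≤K)))
    ... | high K<y _  | mid _ y′≤K _ = ⊥-elim (<⇒≱ (<-trans K<y y<y′) y′≤K)
    ... | high _ e    | high _ e′    rewrite e | e′ = s≤s (s≤s y<y′)

    shift-reflects-< : ∀ {y y′} → shift y < shift y′ → y < y′
    shift-reflects-< {y} {y′} s<s′ with <-cmp y y′
    ... | tri< y<y′ _ _ = y<y′
    ... | tri≈ _ refl _ = ⊥-elim (<-irrefl refl s<s′)
    ... | tri> _ _ y′<y = ⊥-elim (<-asym s<s′ (shift-mono-< y′<y))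

    shift-injective : ∀ {y y′} → shift y ≡ shift y′ → y ≡ y′
    shift-injective {y} {y′} s≡s′ with <-cmp y y′
    ... | tri< y<y′ _ _ = ⊥-elim (<-irrefl s≡s′ (shift-mono-< y<y′))
    ... | tri≈ _ y≡y′ _ = y≡y′
    ... | tri> _ _ y′<y = ⊥-elim (<-irrefl (sym s≡s′) (shift-mono-< y′<y))

    shift-adjacent : ∀ {y y′} → suc (shift y) ≡ shift y′ → y′ ≡ suc y
    shift-adjacent {y} {y′} e with <-cmp y′ (suc y)
    ... | tri≈ _ y′≡y+1 _ = y′≡y+1
    ... | tri< (s≤s y′≤y) _ _ with m≤n⇒m<n∨m≡n y′≤y
    ...   | inj₁ y′<y  = ⊥-elim (<-asym (subst (shift y <_) e (n<1+n _)) (shift-mono-< y′<y))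
    ...   | inj₂ refl  = ⊥-elim (<-irrefl (sym e) (n<1+n _))
    shift-adjacent {y} {y′} e | tri> _ _ y+1<y′ =
      ⊥-elim (<-irrefl e (≤-<-trans (shift-mono-< (n<1+n y)) (shift-mono-< y+1<y′)))

    shift<p⇒<p : ∀ {y} → shift y < p → y < p
    shift<p⇒<p {y} s<p with shift-view y
    ... | low y<p _    = y<p
    ... | mid p≤y _ e  = ⊥-elim (<⇒≱ (subst (_< p) e s<p) (m≤n⇒m≤1+n p≤y))
    ... | high K<y e   = ⊥-elim (<⇒≱ (subst (_< p) e s<p) (m≤n⇒m≤1+n (m≤n⇒m≤1+n (≤-trans p≤K (<⇒≤ K<y)))))

    shift≤2+ : ∀ y → shift y ≤ suc (suc y)
    shift≤2+ y with shift-view y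
    ... | low _ e   = subst (_≤ suc (suc y)) (sym e) (m≤n⇒m≤1+n (n≤1+n y))
    ... | mid _ _ e = subst (_≤ suc (suc y)) (sym e) (n≤1+n _)
    ... | high _ e  = subst (_≤ suc (suc y)) (sym e) ≤-refl

    shift-complement : ∀ y → y < n → shift (c y) + shift y ≡ suc n
    shift-complement y y<n with shift-view y
    ... | low y<p e rewrite e | shift-high {c y} (c-reverses-< y<p p<n) =
      cong suc (trans (sym (+-suc (c y) y)) (m∸n+n≡m y<n))
    ... | mid p≤y y≤K e rewrite e | shift-mid {c y} (subst (_≤ c y) c-K (c-reverses-≤ y≤K)) (c-reverses-≤ p≤y) =
      cong suc (m∸n+n≡m y<n)
    ... | high K<y e rewrite e | shift-low {c y} (subst (c y <_) c-K (c-reverses-< K<y y<n)) =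
      trans (+-suc (c y) (suc y)) (cong suc (m∸n+n≡m y<n))

    min-pos : ℕ
    min-pos = suc (suc K)

    shift-before-max : ∀ {y} → suc (shift y) ≡ p → p ≡ suc y
    shift-before-max {y} e with shift-view y
    ... | low _ e′     = trans (sym e) (cong suc e′)
    ... | mid p≤y _ e′ = ⊥-elim (<⇒≱ (subst (y <_) (trans (cong suc (sym e′)) e) (m≤n⇒m≤1+n (n<1+n y))) p≤y)
    ... | high K<y e′  = ⊥-elim (<⇒≱ (subst (y <_) (trans (cong suc (sym e′)) e) (m<n+m y (s≤s z≤n)))
                                     (≤-trans p≤K (<⇒≤ K<y)))

    shift-before-min : ∀ {y} → suc (shift y) ≡ min-pos → y ≡ K
    shift-before-min {y} e with shift-view y
    ... | low y<p e′  = ⊥-elim (<-irrefl (suc-injective (trans (cong suc (sym e′)) e))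
                                        (<-≤-trans y<p (m≤n⇒m≤1+n p≤K)))
    ... | mid _ _ e′  = suc-injective (suc-injective (trans (cong suc (sym e′)) e))
    ... | high K<y e′ = ⊥-elim (<-irrefl (sym (suc-injective (suc-injective (trans (cong suc (sym e′)) e))))
                                        (<-trans K<y (n<1+n y)))

    min-pos<shift⇒K< : ∀ {y} → min-pos < shift y → K < y
    min-pos<shift⇒K< {y} lt with shift-view y
    ... | low y<p e   = ⊥-elim (<⇒≱ (subst (min-pos <_) e lt) (m≤n⇒m≤1+n (m≤n⇒m≤1+n (≤-trans (<⇒≤ y<p) p≤K))))
    ... | mid _ y≤K e = ⊥-elim (<⇒≱ (subst (min-pos <_) e lt) (s≤s (m≤n⇒m≤1+n y≤K)))
    ... | high K<y _  = K<y

    data Position (x : ℕ) : Set where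
      is-max : x ≡ p → Position x
      is-min : x ≡ min-pos → Position x
      is-old : ∀ y → y < n → x ≡ shift y → Position x

    position-view : ∀ x → x < suc (suc n) → Position x
    position-view x _ with <-cmp x p
    ... | tri< x<p _ _ = is-old x (<-trans x<p p<n) (sym (shift-low x<p))
    ... | tri≈ _ x≡p _ = is-max x≡p
    position-view (suc x) _ | tri> _ _ (s≤s p≤x) with x ≤? K
    ... | yes x≤K = is-old x (≤-<-trans x≤K K<n) (sym (shift-mid p≤x x≤K))
    ... | no  x≰K with <-cmp x (suc K)
    ...   | tri< x<K+1 _ _ = ⊥-elim (x≰K (≤-pred x<K+1))
    ...   | tri≈ _ x≡K+1 _ = is-min (cong suc x≡K+1)
    position-view (suc (suc x)) (s≤s (s≤s x<n)) | tri> _ _ _ | no _ | tri> _ _ (s≤s K<x) =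
      is-old x x<n (sym (shift-high K<x))

    shift-p : shift p ≡ suc p
    shift-p = shift-mid ≤-refl p≤K

    shift-K+1 : shift (suc K) ≡ suc min-pos
    shift-K+1 = shift-high (n<1+n K)

    data Successor (z : ℕ) : Set where
      next-max : p ≡ suc z → suc (shift z) ≡ p → Successor z
      next-min : z ≡ K → suc (shift z) ≡ min-pos → Successor z
      next-old : suc z < n → suc (shift z) ≡ shift (suc z) → Successor z

    successor : ∀ z → suc (shift z) < suc (suc n) → Successor z
    successor z z+1<n+2 with position-view (suc (shift z)) z+1<n+2
    ... | is-max e = next-max (shift-before-max e) e
    ... | is-min e = next-min (shift-before-min e) e
    ... | is-old y y<n e with shift-adjacent e
    ...   | refl = next-old y<n e

    after-min : suc min-pos < suc (suc n) → suc K < n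
    after-min m+1<n+2 with position-view (suc min-pos) m+1<n+2
    ... | is-max e = ⊥-elim (<-irrefl (sym e) (s≤s (m≤n⇒m≤1+n (m≤n⇒m≤1+n p≤K))))
    ... | is-min e = ⊥-elim (<-irrefl (sym e) (n<1+n _))
    ... | is-old y y<n e with shift-injective (trans shift-K+1 e)
    ...   | refl = y<n

    layout : ℕ → ℕ → List ℕ → List ℕ
    layout x-min x-max l = insertAt min-pos x-min (insertAt p x-max l)

    module Layout (l : List ℕ) (l≡n : length l ≡ n) where
      p≤l : p ≤ length l
      p≤l = subst (p ≤_) (sym l≡n) (<⇒≤ p<n)

      length-insertAt-p : ∀ x-max → length (insertAt p x-max l) ≡ suc n
      length-insertAt-p x-max = trans (length-insertAt p x-max l p≤l) (cong suc l≡n)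

      min-pos≤ : ∀ x-max → min-pos ≤ length (insertAt p x-max l)
      min-pos≤ x-max = subst (min-pos ≤_) (sym (length-insertAt-p x-max)) (s≤s K<n)

      length-layout : ∀ x-min x-max → length (layout x-min x-max l) ≡ suc (suc n)
      length-layout x-min x-max =
        trans (length-insertAt min-pos x-min (insertAt p x-max l) (min-pos≤ x-max)) (cong suc (length-insertAt-p x-max))

      at-layout-max : ∀ x-min x-max → at (layout x-min x-max l) p ≡ x-max
      at-layout-max x-min x-max =
        trans (at-insertAt-< min-pos x-min (insertAt p x-max l) p (s≤s (m≤n⇒m≤1+n p≤K)) (min-pos≤ x-max)) (at-insertAt-≡ p x-max l p≤l)

      at-layout-min : ∀ x-min x-max → at (layout x-min x-max l) min-pos ≡ x-min
      at-layout-min x-min x-max = at-insertAt-≡ min-pos x-min (insertAt p x-max l) (min-pos≤ x-max)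

      at-layout-old : ∀ x-min x-max y → at (layout x-min x-max l) (shift y) ≡ at l y
      at-layout-old x-min x-max y with shift-view y
      ... | low y<p e rewrite e =
        trans (at-insertAt-< min-pos x-min (insertAt p x-max l) y (<-trans y<p (s≤s (m≤n⇒m≤1+n p≤K))) (min-pos≤ x-max))
              (at-insertAt-< p x-max l y y<p p≤l)
      ... | mid p≤y y≤K e rewrite e =
        trans (at-insertAt-< min-pos x-min (insertAt p x-max l) (suc y) (s≤s (s≤s y≤K)) (min-pos≤ x-max))
              (at-insertAt-> p x-max l y p≤y p≤l)
      ... | high K<y e rewrite e =
        trans (at-insertAt-> min-pos x-min (insertAt p x-max l) (suc y) (s≤s K<y) (min-pos≤ x-max))
              (at-insertAt-> p x-max l y (≤-trans p≤K (<⇒≤ K<y)) p≤l)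

    -- Entries are doubled (the 0-based value x becomes 2x+2) so that the new entries get fresh values:
    -- the maximum 2n+2, the minimum 0, the first entry 2p+1 and the last entry 2K+3.
    max-value : ℕ
    max-value = suc (suc (double n))

    old-value : ℕ → ℕ
    old-value y = suc (suc (double (v y)))

    first-value : ℕ
    first-value = suc (double p)

    last-value : ℕ
    last-value = suc (double (suc K))

    old<max : ∀ y → y < n → old-value y < max-value
    old<max y y<n = s≤s (s≤s (double-mono-< (v-< y y<n)))

    first<max : first-value < max-value
    first<max = s≤s (m≤n⇒m≤1+n (double-mono-< p<n))

    last<max : last-value < max-value
    last<max = s≤s (s≤s (double-mono-≤ K<n))

    first<last : first-value < last-value
    first<last = s≤s (double-mono-< (s≤s p≤K))

    old<first⇒ : ∀ y → old-value y < first-value → v y < p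
    old<first⇒ y = even<odd⇒< (v y) p

    first<old⇒ : ∀ y → first-value < old-value y → p ≤ v y
    first<old⇒ y = odd<even⇒≤ (v y) p

    old<last⇒ : ∀ y → old-value y < last-value → v y ≤ K
    old<last⇒ y h = ≤-pred (even<odd⇒< (v y) (suc K) h)

    last<old⇒ : ∀ y → last-value < old-value y → K < v y
    last<old⇒ y = odd<even⇒≤ (v y) (suc K)

    old<old⇒ : ∀ x y → old-value x < old-value y → v x < v y
    old<old⇒ x y = even<even⇒< (v x) (v y)

    module Insertions (l : List ℕ) (l≡n : length l ≡ n) (at-l : ∀ y → y < n → at l y ≡ old-value y)
                      (no-pattern-with-max : NoBaxterPattern (insertAt p max-value l)) where
      open Layout l l≡n

      with-max : List ℕ
      with-max = insertAt p max-value l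

      with-min : List ℕ
      with-min = layout 0 max-value l

      with-first : List ℕ
      with-first = first-value ∷ with-min

      with-last : List ℕ
      with-last = with-first ++ last-value ∷ []

      at-with-max-low : ∀ y → y < p → at with-max y ≡ old-value y
      at-with-max-low y y<p = trans (at-insertAt-< p max-value l y y<p p≤l) (at-l y (<-trans y<p p<n))

      at-with-max-high : ∀ y → p ≤ y → y < n → at with-max (suc y) ≡ old-value y
      at-with-max-high y p≤y y<n = trans (at-insertAt-> p max-value l y p≤y p≤l) (at-l y y<n)

      at-with-max-max : at with-max p ≡ max-value
      at-with-max-max = at-insertAt-≡ p max-value l p≤l

      at-max : ∀ {x} → x ≡ p → at with-min x ≡ max-value
      at-max refl = at-layout-max 0 max-value

      at-min : ∀ {x} → x ≡ min-pos → at with-min x ≡ 0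
      at-min refl = at-layout-min 0 max-value

      at-old : ∀ {x} y → y < n → x ≡ shift y → at with-min x ≡ old-value y
      at-old y y<n refl = trans (at-layout-old 0 max-value y) (at-l y y<n)

      at-with-min≤max : ∀ x → x < suc (suc n) → at with-min x ≤ max-value
      at-with-min≤max x x<n+2 with position-view x x<n+2
      ... | is-max e       = ≤-reflexive (at-max e)
      ... | is-min e       = subst (_≤ max-value) (sym (at-min e)) z≤n
      ... | is-old y y<n e = subst (_≤ max-value) (sym (at-old y y<n e)) (<⇒≤ (old<max y y<n))

      min-as-left-3142 : ∀ p′ → p ≡ suc p′ → ∀ i k → i < min-pos → suc K < k → k < n →
                         old-value k < at with-max i → at with-max i < old-value (suc K) → ⊥
      min-as-left-3142 p′ p≡ i k i<m K+1<k k<n k<i i<K+1 with <-cmp i p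
      ... | tri< i<p _ _ =
        no-3142-min p′ p≡ i k (<-≤-trans i<p (m≤n⇒m≤1+n p≤K)) K+1<k k<n
          (old<old⇒ k i (subst (old-value k <_) (at-with-max-low i i<p) k<i) ,
           old<old⇒ i (suc K) (subst (_< old-value (suc K)) (at-with-max-low i i<p) i<K+1))
      ... | tri≈ _ refl _ =
        <-asym (subst (_< old-value (suc K)) at-with-max-max i<K+1) (old<max (suc K) (<-trans K+1<k k<n))
      min-as-left-3142 p′ p≡ (suc i) k i<m K+1<k k<n k<i i<K+1 | tri> _ _ p<i+1 =
        no-3142-min p′ p≡ i k (≤-pred i<m) K+1<k k<n
          (old<old⇒ k i (subst (old-value k <_) at-i k<i) , old<old⇒ i (suc K) (subst (_< old-value (suc K)) at-i i<K+1))
        where at-i = at-with-max-high i (≤-pred p<i+1) (<-trans (≤-pred i<m) (<-trans K+1<k k<n))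

      min-as-right-2413 : ∀ i k → suc i < min-pos → K < k → k < n →
                          at with-max i < old-value k → old-value k < old-value K → ⊥
      min-as-right-2413 i k i<m K<k k<n i<k k<K with <-cmp i p
      ... | tri< i<p _ _ =
        no-2413-min i k (<-≤-trans i<p p≤K) K<k k<n
          (old<old⇒ i k (subst (_< old-value k) (at-with-max-low i i<p) i<k) , old<old⇒ k K k<K)
      ... | tri≈ _ refl _ = <-asym (subst (_< old-value k) at-with-max-max i<k) (old<max k k<n)
      min-as-right-2413 (suc i) k i<m K<k k<n i<k k<K | tri> _ _ p<i+1 =
        no-2413-min i k (≤-pred (≤-pred i<m)) K<k k<n
          (old<old⇒ i k (subst (_< old-value k) at-i i<k) , old<old⇒ k K k<K)
        where at-i = at-with-max-high i (≤-pred p<i+1) (<-trans (≤-pred (≤-pred i<m)) K<n)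

      min-safe : InsertionSafe min-pos 0 with-max
      min-safe .as-first _ _ _ _ _ (inj₁ (_ , d<0 , _)) = n≮0 d<0
      min-safe .as-first _ _ _ _ _ (inj₂ (c<0 , _ , _)) = n≮0 c<0
      min-safe .as-last _ _ _ _ (inj₁ (b<0 , _ , _)) = n≮0 b<0
      min-safe .as-last _ _ _ _ (inj₂ (_ , a<0 , _)) = n≮0 a<0
      min-safe .as-left _ _ _ _ _ (inj₂ (_ , _ , d<0)) = n≮0 d<0
      min-safe .as-left i (suc k) i<m (s≤s K+1<k) k<wm (inj₁ (_ , k<i , i<K+1)) =
        min-as-left-3142 p′ p≡ i k i<m K+1<k k<n
          (subst (_< at with-max i) (at-with-max-high k (≤-trans p≤K (<⇒≤ (<-trans (n<1+n K) K+1<k))) k<n) k<i)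
          (subst (at with-max i <_) (at-with-max-high (suc K) (m≤n⇒m≤1+n p≤K) K+1<n) i<K+1)
        where
        k<n = ≤-pred (subst (suc k <_) (length-insertAt-p max-value) k<wm)
        K+1<n = <-trans K+1<k k<n
        p′ = proj₁ (positive⇒suc (K<⇒0<p K+1<n (n<1+n K)))
        p≡ = proj₂ (positive⇒suc (K<⇒0<p K+1<n (n<1+n K)))
      min-safe .as-right _ _ _ _ _ (inj₁ (_ , _ , a<0)) = n≮0 a<0
      min-safe .as-right i (suc k) i<m (s≤s K<k) k<wm (inj₂ (_ , i<k , k<K)) =
        min-as-right-2413 i k i<m K<k k<n (subst (at with-max i <_) at-k i<k)
          (subst₂ _<_ at-k (at-with-max-high K p≤K K<n) k<K)
        where
        k<n = ≤-pred (subst (suc k <_) (length-insertAt-p max-value) k<wm)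
        at-k = at-with-max-high k (≤-trans p≤K (<⇒≤ K<k)) k<n

      no-pattern-with-min : NoBaxterPattern with-min
      no-pattern-with-min =
        NoBaxterPattern-insertAt min-pos 0 with-max (min-pos≤ max-value) no-pattern-with-max min-safe

      no-pattern-first-to-old : ∀ j y → suc j < suc (suc n) → suc j < shift y → y < n →
                                ¬ BaxterPattern first-value (at with-min j) (at with-min (suc j)) (old-value y)
      no-pattern-first-to-old j y j+1<n+2 j+1<y y<n pat with position-view j (<-trans (n<1+n j) j+1<n+2)
      ... | is-max refl = refute (BaxterPattern-cong refl (at-max refl) (at-old p p<n (sym shift-p)) refl pat)
        where
        refute : ¬ BaxterPattern first-value max-value (old-value p) (old-value y)
        refute (inj₁ (max<y , _ , _)) = <-asym max<y (old<max y y<n)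
        refute (inj₂ (p<first , _ , _)) = ≤⇒≯ p≤v[p] (old<first⇒ p p<first)
      ... | is-min refl = refute (BaxterPattern-cong refl (at-min refl) (at-old (suc K) (after-min j+1<n+2) (sym shift-K+1)) refl pat)
        where
        refute : ¬ BaxterPattern first-value 0 (old-value (suc K)) (old-value y)
        refute (inj₂ (_ , _ , y<0)) = n≮0 y<0
        refute (inj₁ (_ , y<first , first<K+1)) with positive⇒suc (≤-<-trans z≤n (old<first⇒ y y<first))
        ... | p′ , p≡ = no-3142-first-min p′ p≡ y (shift-reflects-< (subst (_< shift y) (sym shift-K+1) j+1<y)) y<n
                          (old<first⇒ y y<first) (first<old⇒ (suc K) first<K+1)
      ... | is-old z z<n refl with successor z j+1<n+2
      ...   | next-max p≡ e = refute (BaxterPattern-cong refl (at-old z z<n refl) (at-max e) refl pat)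
        where
        refute : ¬ BaxterPattern first-value (old-value z) max-value (old-value y)
        refute (inj₁ (z<y , y<first , _)) = ≤⇒≯ (p≤v[p′] z p≡) (<-trans (old<old⇒ z y z<y) (old<first⇒ y y<first))
        refute (inj₂ (max<first , _ , _)) = <-asym max<first first<max
      ...   | next-min refl e = refute (BaxterPattern-cong refl (at-old K z<n refl) (at-min e) refl pat)
        where
        refute : ¬ BaxterPattern first-value (old-value K) 0 (old-value y)
        refute (inj₁ (_ , _ , first<0)) = n≮0 first<0
        refute (inj₂ (_ , first<y , y<K)) =
          no-2413-first-min y (min-pos<shift⇒K< (subst (_< shift y) e j+1<y)) y<n (first<old⇒ y first<y) (old<old⇒ y K y<K)
      ...   | next-old z+1<n e = refute (BaxterPattern-cong refl (at-old z z<n refl) (at-old (suc z) z+1<n e) refl pat)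
        where
        z+1<y = shift-reflects-< (subst (_< shift y) e j+1<y)
        refute : ¬ BaxterPattern first-value (old-value z) (old-value (suc z)) (old-value y)
        refute (inj₁ (z<y , y<first , first<z+1)) =
          no-3142-first z y z+1<y y<n (old<old⇒ z y z<y) (old<first⇒ y y<first) (first<old⇒ (suc z) first<z+1)
        refute (inj₂ (z+1<first , first<y , y<z)) =
          no-2413-first z y z+1<y y<n (old<first⇒ (suc z) z+1<first) (first<old⇒ y first<y) (old<old⇒ y z y<z)

      first-safe : ∀ j k → suc j < k → k < length with-min →
                   ¬ BaxterPattern first-value (at with-min j) (at with-min (suc j)) (at with-min k)
      first-safe j k j+1<k k<wm pat with position-view k (subst (k <_) (length-layout 0 max-value) k<wm)
      ... | is-max refl = refute (BaxterPattern-cong refl refl refl (at-max refl) pat)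
        where
        refute : ¬ BaxterPattern first-value (at with-min j) (at with-min (suc j)) max-value
        refute (inj₁ (_ , max<first , _)) = <-asym max<first first<max
        refute (inj₂ (_ , _ , max<j)) =
          <⇒≱ max<j (at-with-min≤max j (<-trans (<-trans (n<1+n j) j+1<k) (subst (p <_) (length-layout 0 max-value) k<wm)))
      ... | is-min refl = refute (BaxterPattern-cong refl refl refl (at-min refl) pat)
        where
        refute : ¬ BaxterPattern first-value (at with-min j) (at with-min (suc j)) 0
        refute (inj₁ (j<0 , _ , _)) = n≮0 j<0
        refute (inj₂ (_ , first<0 , _)) = n≮0 first<0
      ... | is-old y y<n refl =
        no-pattern-first-to-old j y (<-trans j+1<k (subst (shift y <_) (length-layout 0 max-value) k<wm)) j+1<k y<n
          (BaxterPattern-cong refl refl refl (at-old y y<n refl) pat)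

      no-pattern-with-first : NoBaxterPattern with-first
      no-pattern-with-first = NoBaxterPattern-∷ first-value with-min no-pattern-with-min first-safe

      no-pattern-first-to-last : ∀ j → suc j < suc (suc n) →
                                 ¬ BaxterPattern first-value (at with-min j) (at with-min (suc j)) last-value
      no-pattern-first-to-last j _ (inj₁ (_ , last<first , _)) = <-asym last<first first<last
      no-pattern-first-to-last j j+1<n+2 (inj₂ (j+1<first , _ , last<j)) with position-view j (<-trans (n<1+n j) j+1<n+2)
      ... | is-max refl = ≤⇒≯ p≤v[p] (old<first⇒ p (subst (_< first-value) (at-old p p<n (sym shift-p)) j+1<first))
      ... | is-min refl = n≮0 (subst (last-value <_) (at-min refl) last<j)
      ... | is-old y y<n refl with successor y j+1<n+2
      ...   | next-max _ e = <-asym (subst (_< first-value) (at-max e) j+1<first) first<max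
      ...   | next-min refl _ = ≤⇒≯ v[K]≤K (last<old⇒ K (subst (last-value <_) (at-old K y<n refl) last<j))
      ...   | next-old y+1<n e =
        no-2413-first-last y y+1<n (old<first⇒ (suc y) (subst (_< first-value) (at-old (suc y) y+1<n e) j+1<first))
          (last<old⇒ y (subst (last-value <_) (at-old y y<n refl) last<j))

      no-pattern-old-to-last : ∀ z j → z < n → shift z < j → suc j < suc (suc n) →
                               ¬ BaxterPattern (old-value z) (at with-min j) (at with-min (suc j)) last-value
      no-pattern-old-to-last z j z<n z<j j+1<n+2 pat with position-view j (<-trans (n<1+n j) j+1<n+2)
      ... | is-max refl = refute (BaxterPattern-cong refl (at-max refl) (at-old p p<n (sym shift-p)) refl pat)
        where
        refute : ¬ BaxterPattern (old-value z) max-value (old-value p) last-value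
        refute (inj₁ (max<last , _ , _)) = <-asym max<last last<max
        refute (inj₂ (p<z , z<last , _)) = no-2413-max-last z (shift<p⇒<p z<j) (old<old⇒ p z p<z) (old<last⇒ z z<last)
      ... | is-min refl = refute (BaxterPattern-cong refl (at-min refl) (at-old (suc K) K+1<n (sym shift-K+1)) refl pat)
        where
        K+1<n = after-min j+1<n+2
        refute : ¬ BaxterPattern (old-value z) 0 (old-value (suc K)) last-value
        refute (inj₂ (_ , _ , last<0)) = n≮0 last<0
        refute (inj₁ (_ , last<z , z<K+1)) with positive⇒suc (K<⇒0<p K+1<n (n<1+n K))
        ... | p′ , p≡ = ≤⇒≯ (v[K+1]≤K p′ p≡) (<-trans (last<old⇒ z last<z) (old<old⇒ z (suc K) z<K+1))
      ... | is-old y y<n refl with successor y j+1<n+2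
      ...   | next-max p≡ e = refute (BaxterPattern-cong refl (at-old y y<n refl) (at-max e) refl pat)
        where
        refute : ¬ BaxterPattern (old-value z) (old-value y) max-value last-value
        refute (inj₁ (y<last , last<z , _)) =
          no-3142-max-last y p≡ z (shift-reflects-< z<j) (last<old⇒ z last<z) (old<last⇒ y y<last)
        refute (inj₂ (max<z , _ , _)) = <-asym max<z (old<max z z<n)
      ...   | next-min refl e = refute (BaxterPattern-cong refl (at-old K y<n refl) (at-min e) refl pat)
        where
        refute : ¬ BaxterPattern (old-value z) (old-value K) 0 last-value
        refute (inj₁ (_ , _ , z<0)) = n≮0 z<0
        refute (inj₂ (_ , _ , last<K)) = ≤⇒≯ v[K]≤K (last<old⇒ K last<K)
      ...   | next-old y+1<n e = refute (BaxterPattern-cong refl (at-old y y<n refl) (at-old (suc y) y+1<n e) refl pat)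
        where
        refute : ¬ BaxterPattern (old-value z) (old-value y) (old-value (suc y)) last-value
        refute (inj₁ (y<last , last<z , z<y+1)) =
          no-3142-last z y (shift-reflects-< z<j) y+1<n (old<last⇒ y y<last) (last<old⇒ z last<z) (old<old⇒ z (suc y) z<y+1)
        refute (inj₂ (y+1<z , z<last , last<y)) =
          no-2413-last z y (shift-reflects-< z<j) y+1<n (old<old⇒ (suc y) z y+1<z) (old<last⇒ z z<last) (last<old⇒ y last<y)

      no-pattern-to-last : ∀ i j → i < j → suc j < suc (suc n) →
                           ¬ BaxterPattern (at with-min i) (at with-min j) (at with-min (suc j)) last-value
      no-pattern-to-last i j i<j j+1<n+2 pat with position-view i (<-trans i<j (<-trans (n<1+n j) j+1<n+2))
      ... | is-max refl = refute (BaxterPattern-cong (at-max refl) refl refl refl pat)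
        where
        refute : ¬ BaxterPattern max-value (at with-min j) (at with-min (suc j)) last-value
        refute (inj₁ (_ , _ , max<j+1)) = <⇒≱ max<j+1 (at-with-min≤max (suc j) j+1<n+2)
        refute (inj₂ (_ , max<last , _)) = <-asym max<last last<max
      ... | is-min refl = refute (BaxterPattern-cong (at-min refl) refl refl refl pat)
        where
        refute : ¬ BaxterPattern 0 (at with-min j) (at with-min (suc j)) last-value
        refute (inj₁ (_ , last<0 , _)) = n≮0 last<0
        refute (inj₂ (j+1<0 , _ , _)) = n≮0 j+1<0
      ... | is-old z z<n refl = no-pattern-old-to-last z j z<n i<j j+1<n+2 (BaxterPattern-cong (at-old z z<n refl) refl refl refl pat)

      last-safe : ∀ i j → i < j → suc j < length with-first →
                  ¬ BaxterPattern (at with-first i) (at with-first j) (at with-first (suc j)) last-value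
      last-safe zero    (suc j) _         j+1<wf = no-pattern-first-to-last j (subst (suc (suc j) ≤_) (length-layout 0 max-value) (≤-pred j+1<wf))
      last-safe (suc i) (suc j) (s≤s i<j) j+1<wf = no-pattern-to-last i j i<j (subst (suc (suc j) ≤_) (length-layout 0 max-value) (≤-pred j+1<wf))

      no-pattern-with-last : NoBaxterPattern with-last
      no-pattern-with-last = NoBaxterPattern-∷ʳ last-value with-first no-pattern-with-first last-safe

    compress : ℕ → ℕ
    compress x = step first-value x + (step last-value x + suc ⌊ x /2⌋)

    compress-mono : Monotone compress
    compress-mono x≤y =
      +-mono-≤ (step-mono first-value x≤y) (+-mono-≤ (step-mono last-value x≤y) (s≤s (⌊n/2⌋-mono x≤y)))

    compress-max : compress max-value ≡ suc (suc (suc (suc n)))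
    compress-max rewrite step-≥ (<⇒≤ first<max) | step-≥ (<⇒≤ last<max) | ⌊double/2⌋ n = refl

    compress-first : compress first-value ≡ suc (suc p)
    compress-first rewrite step-≥ (≤-refl {first-value}) | step-< first<last | ⌊1+double/2⌋ p = refl

    compress-last : compress last-value ≡ suc (suc (suc (suc K)))
    compress-last rewrite step-≥ (<⇒≤ first<last) | step-≥ (≤-refl {last-value}) | ⌊1+double/2⌋ (suc K) = refl

    compress-even : ∀ z → compress (suc (suc (double z))) ≡ suc (suc (shift z))
    compress-even z with shift-view z
    ... | low z<p e rewrite e | ⌊double/2⌋ z
                          | step-< {first-value} {suc (suc (double z))} (s≤s (double-mono-≤ z<p))
                          | step-< {last-value} {suc (suc (double z))} (s≤s (s≤s (s≤s (double-mono-≤ (≤-trans (<⇒≤ z<p) p≤K))))) = refl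
    ... | mid p≤z z≤K e rewrite e | ⌊double/2⌋ z
                              | step-≥ {first-value} {suc (suc (double z))} (s≤s (m≤n⇒m≤1+n (double-mono-≤ p≤z)))
                              | step-< {last-value} {suc (suc (double z))} (s≤s (s≤s (s≤s (double-mono-≤ z≤K)))) = refl
    ... | high K<z e rewrite e | ⌊double/2⌋ z
                           | step-≥ {first-value} {suc (suc (double z))} (s≤s (m≤n⇒m≤1+n (double-mono-≤ (≤-trans p≤K (<⇒≤ K<z)))))
                           | step-≥ {last-value} {suc (suc (double z))} (s≤s (s≤s (≤-trans (n≤1+n _) (double-mono-≤ K<z)))) = refl

    relabel : ℕ → ℕ
    relabel x = compress (double x)

    relabel-suc : ∀ z → relabel (suc z) ≡ suc (suc (shift z))
    relabel-suc = compress-even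

    relabel-mono : StrictlyMonotone relabel
    relabel-mono {zero}  {suc y} _ rewrite relabel-suc y = s≤s (s≤s z≤n)
    relabel-mono {suc x} {suc y} (s≤s x<y) rewrite relabel-suc x | relabel-suc y = s≤s (s≤s (shift-mono-< x<y))

    relabelled-range : List ℕ
    relabelled-range = map relabel (applyUpTo suc n)

    length-relabelled-range : length relabelled-range ≡ n
    length-relabelled-range = trans (length-map relabel (applyUpTo suc n)) (length-applyUpTo suc n)

    layout-relabelled-range :
      applyUpTo (λ x → suc (suc x)) (suc (suc (suc n))) ≡
      layout (suc (suc (suc (suc K)))) (suc (suc p)) relabelled-range ++ suc (suc (suc (suc n))) ∷ []
    layout-relabelled-range = at-extensionality R (L ++ N ∷ []) same-length same-entries
      where
      open Layout relabelled-range length-relabelled-range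
      plus2 : ℕ → ℕ
      plus2 x = suc (suc x)
      R = applyUpTo plus2 (suc (suc (suc n)))
      N = suc (suc (suc (suc n)))
      L = layout (suc (suc (suc (suc K)))) (suc (suc p)) relabelled-range
      length-R : length R ≡ suc (suc (suc n))
      length-R = length-applyUpTo plus2 (suc (suc (suc n)))
      length-L : length L ≡ suc (suc n)
      length-L = length-layout (suc (suc (suc (suc K)))) (suc (suc p))
      same-length : length R ≡ length (L ++ N ∷ [])
      same-length = trans length-R (sym (trans (length-++ L) (trans (cong (_+ 1) length-L) (+-comm (suc (suc n)) 1))))
      entry : ∀ y → Position y → at L y ≡ suc (suc y)
      entry y (is-max refl) = at-layout-max (suc (suc (suc (suc K)))) (suc (suc p))
      entry y (is-min refl) = at-layout-min (suc (suc (suc (suc K)))) (suc (suc p))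
      entry y (is-old y′ y′<n refl) = begin
        at L (shift y′)                        ≡⟨ at-layout-old (suc (suc (suc (suc K)))) (suc (suc p)) y′ ⟩
        at relabelled-range y′                 ≡⟨ at-map relabel (applyUpTo suc n) y′ (subst (y′ <_) (sym (length-applyUpTo suc n)) y′<n) ⟩
        relabel (at (applyUpTo suc n) y′)      ≡⟨ cong relabel (at-applyUpTo suc n y′ y′<n) ⟩
        relabel (suc y′)                       ≡⟨ relabel-suc y′ ⟩
        suc (suc (shift y′))                   ∎
        where open ≡-Reasoning
      same-entries : ∀ y → y < length R → at R y ≡ at (L ++ N ∷ []) y
      same-entries y y<R with m≤n⇒m<n∨m≡n (≤-pred (subst (y <_) length-R y<R))
      ... | inj₁ y<n+2 = trans (at-applyUpTo plus2 (suc (suc (suc n))) y (<-trans y<n+2 (n<1+n _)))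
          (sym (trans (at-++ˡ L (N ∷ []) y (subst (y <_) (sym length-L) y<n+2)) (entry y (position-view y y<n+2))))
      ... | inj₂ refl = trans (at-applyUpTo plus2 (suc (suc (suc n))) (suc (suc n)) (n<1+n _))
          (sym (subst (λ t → at (L ++ N ∷ []) t ≡ N) length-L (at-length-++ L N [])))

    layout-↭ : ∀ x-min x-max (l : List ℕ) → layout x-min x-max l ↭ x-min ∷ x-max ∷ l
    layout-↭ x-min x-max l = ↭-trans (insertAt-↭ min-pos x-min (insertAt p x-max l)) (prep x-min (insertAt-↭ p x-max l))

    framed-layout-↭ : ∀ a x-min x-max b (l : List ℕ) →
                      a ∷ (layout x-min x-max l ++ b ∷ []) ↭ a ∷ x-min ∷ x-max ∷ b ∷ l
    framed-layout-↭ a x-min x-max b l =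
      prep a (↭-trans (++⁺ʳ (b ∷ []) (layout-↭ x-min x-max l)) (prep x-min (prep x-max (++-comm l (b ∷ [])))))

    module Construction (w : List ℕ) (w≡n : length w ≡ n) (at-w : ∀ i → i < n → at w i ≡ suc (v i))
                        (w↭ : IsPerm n w) (no-pattern-with-n+1 : NoBaxterPattern (insertAt p (suc n) w)) where
      l : List ℕ
      l = map double w

      l≡n : length l ≡ n
      l≡n = trans (length-map double w) w≡n

      at-l : ∀ y → y < n → at l y ≡ old-value y
      at-l y y<n = trans (at-map double w y (subst (y <_) (sym w≡n) y<n)) (cong double (at-w y y<n))

      no-pattern-with-max′ : NoBaxterPattern (insertAt p max-value l)
      no-pattern-with-max′ = subst NoBaxterPattern (map-insertAt double p (suc n) w)
        (NoBaxterPattern-map double double-mono-≤ (insertAt p (suc n) w) no-pattern-with-n+1)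

      open Insertions l l≡n at-l no-pattern-with-max′

      u : List ℕ
      u = map relabel w

      length-u : length u ≡ n
      length-u = trans (length-map relabel w) w≡n

      m : List ℕ
      m = map compress with-min

      w′ : List ℕ
      w′ = map compress with-last

      m≡layout : m ≡ layout 1 (suc (suc (suc (suc n)))) u
      m≡layout = begin
        map compress (insertAt min-pos 0 with-max)                      ≡⟨ map-insertAt compress min-pos 0 with-max ⟩
        insertAt min-pos 1 (map compress (insertAt p max-value l))       ≡⟨ cong (insertAt min-pos 1) (map-insertAt compress p max-value l) ⟩
        insertAt min-pos 1 (insertAt p (compress max-value) (map compress l))
          ≡⟨ cong₂ (λ x xs → insertAt min-pos 1 (insertAt p x xs)) compress-max (sym (map-∘ w)) ⟩
        layout 1 (suc (suc (suc (suc n)))) u                             ∎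
        where open ≡-Reasoning

      w′≡ : w′ ≡ suc (suc p) ∷ (m ++ suc (suc (suc (suc K))) ∷ [])
      w′≡ = cong₂ _∷_ compress-first
        (trans (map-++ compress with-min (last-value ∷ [])) (cong (λ x → m ++ x ∷ []) compress-last))

      w′-baxter : Baxter w′
      w′-baxter = NoBaxterPattern⇒Baxter w′ (NoBaxterPattern-map compress compress-mono with-last no-pattern-with-last)

      1∈m : 1 ∈ m
      1∈m = subst (1 ∈_) (sym m≡layout) (∈-insertAt min-pos 1 (insertAt p (suc (suc (suc (suc n)))) u))

      u≢1 : All (_≢ 1) u
      u≢1 = All.map⁺ (All-resp-↭ (↭-sym w↭) (All.applyUpTo⁺₁ suc n λ {i} _ e →
        1+n≢0 (suc-injective (trans (sym (relabel-suc i)) e))))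

      removeOne-m : removeOne m ≡ insertAt p (n + 4) u
      removeOne-m = begin
        removeOne m                                                   ≡⟨ cong removeOne m≡layout ⟩
        removeOne (insertAt min-pos 1 (insertAt p (suc (suc (suc (suc n)))) u))
          ≡⟨ removeOne-insertAt min-pos _ (All-insertAt p _ u (λ ()) u≢1) ⟩
        insertAt p (suc (suc (suc (suc n)))) u                        ≡⟨ cong (λ x → insertAt p x u) (+-comm 4 n) ⟩
        insertAt p (n + 4) u                                          ∎
        where open ≡-Reasoning

      standardize-u : standardize u ≡ w
      standardize-u = trans (standardize-map relabel relabel-mono w) (standardize-perm n w w↭)

      module U = Layout u length-u

      length-m : length m ≡ suc (suc n)
      length-m = trans (cong length m≡layout) (U.length-layout 1 (suc (suc (suc (suc n)))))

      length-w′ : length w′ ≡ suc (suc (suc (suc n)))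
      length-w′ = trans (cong length w′≡)
        (cong suc (trans (length-++ m) (trans (cong (_+ 1) length-m) (+-comm (suc (suc n)) 1))))

      at-w′-first : at w′ 0 ≡ suc (suc p)
      at-w′-first = cong (λ xs → at xs 0) w′≡

      at-w′-middle : ∀ x → x < suc (suc n) → at w′ (suc x) ≡ at m x
      at-w′-middle x x<n+2 =
        trans (cong (λ xs → at xs (suc x)) w′≡) (at-++ˡ m _ x (subst (x <_) (sym length-m) x<n+2))

      at-w′-last : at w′ (suc (suc (suc n))) ≡ suc (suc (suc (suc K)))
      at-w′-last = trans (cong (λ xs → at xs (suc (suc (suc n)))) w′≡)
        (subst (λ t → at (m ++ suc (suc (suc (suc K))) ∷ []) t ≡ suc (suc (suc (suc K)))) length-m
               (at-length-++ m (suc (suc (suc (suc K)))) []))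

      at-m-max : at m p ≡ suc (suc (suc (suc n)))
      at-m-max = trans (cong (λ xs → at xs p) m≡layout) (U.at-layout-max 1 (suc (suc (suc (suc n)))))

      at-m-min : at m min-pos ≡ 1
      at-m-min = trans (cong (λ xs → at xs min-pos) m≡layout) (U.at-layout-min 1 (suc (suc (suc (suc n)))))

      at-m-old : ∀ y → y < n → at m (shift y) ≡ suc (suc (shift (v y)))
      at-m-old y y<n = begin
        at m (shift y)                                  ≡⟨ cong (λ xs → at xs (shift y)) m≡layout ⟩
        at (layout 1 (suc (suc (suc (suc n)))) u) (shift y) ≡⟨ U.at-layout-old 1 (suc (suc (suc (suc n)))) y ⟩
        at u y                                          ≡⟨ at-map relabel w y (subst (y <_) (sym w≡n) y<n) ⟩
        relabel (at w y)                                ≡⟨ cong relabel (at-w y y<n) ⟩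
        relabel (suc (v y))                             ≡⟨ relabel-suc (v y) ⟩
        suc (suc (shift (v y)))                         ∎
        where open ≡-Reasoning

      shift<n+2 : ∀ y → y < n → shift y < suc (suc n)
      shift<n+2 y y<n = ≤-<-trans (shift≤2+ y) (s≤s (s≤s y<n))

      n≡1+K+p : n ≡ suc (K + p)
      n≡1+K+p = trans (sym (m∸n+n≡m p<n)) (+-suc K p)

      rotate-first : at w′ (at w′ 0 ∸ 1) ≡ suc (suc (suc (suc n)))
      rotate-first = begin
        at w′ (at w′ 0 ∸ 1)                   ≡⟨ cong (λ x → at w′ (x ∸ 1)) at-w′-first ⟩
        at w′ (suc p)                         ≡⟨ at-w′-middle p (<-trans p<n (<-trans (n<1+n n) (n<1+n _))) ⟩
        at m p                                ≡⟨ at-m-max ⟩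
        suc (suc (suc (suc n)))               ∎
        where open ≡-Reasoning

      rotate-last : at w′ (at w′ (suc (suc (suc n))) ∸ 1) ≡ suc n ∸ n
      rotate-last = begin
        at w′ (at w′ (suc (suc (suc n))) ∸ 1) ≡⟨ cong (λ x → at w′ (x ∸ 1)) at-w′-last ⟩
        at w′ (suc min-pos)                   ≡⟨ at-w′-middle min-pos (s≤s (s≤s K<n)) ⟩
        at m min-pos                          ≡⟨ at-m-min ⟩
        1                                     ≡⟨ m+n∸n≡m 1 n ⟨
        suc n ∸ n                             ∎
        where open ≡-Reasoning

      rotate-max : at w′ (at w′ (suc p) ∸ 1) ≡ suc (suc (suc n)) ∸ p
      rotate-max = begin
        at w′ (at w′ (suc p) ∸ 1)             ≡⟨ cong (λ x → at w′ (x ∸ 1)) (trans (at-w′-middle p p<n+2) at-m-max) ⟩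
        at w′ (suc (suc (suc n)))             ≡⟨ at-w′-last ⟩
        suc (suc (suc (suc K)))               ≡⟨ m+n∸n≡m (suc (suc (suc (suc K)))) p ⟨
        suc (suc (suc (suc K))) + p ∸ p       ≡⟨ cong (λ t → suc (suc (suc t)) ∸ p) n≡1+K+p ⟨
        suc (suc (suc n)) ∸ p                 ∎
        where
        open ≡-Reasoning
        p<n+2 = <-trans p<n (<-trans (n<1+n n) (n<1+n _))

      rotate-min : at w′ (at w′ (suc min-pos) ∸ 1) ≡ suc n ∸ K
      rotate-min = begin
        at w′ (at w′ (suc min-pos) ∸ 1)       ≡⟨ cong (λ x → at w′ (x ∸ 1)) (trans (at-w′-middle min-pos (s≤s (s≤s K<n))) at-m-min) ⟩
        at w′ 0                               ≡⟨ at-w′-first ⟩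
        suc (suc p)                           ≡⟨ m+n∸m≡n K (suc (suc p)) ⟨
        K + suc (suc p) ∸ K                   ≡⟨ cong (_∸ K) (trans (+-suc K (suc p)) (cong suc (+-suc K p))) ⟩
        suc (suc (K + p)) ∸ K                 ≡⟨ cong (λ t → suc t ∸ K) n≡1+K+p ⟨
        suc n ∸ K                             ∎
        where open ≡-Reasoning

      rotate-old : ∀ y → y < n → at w′ (at w′ (suc (shift y)) ∸ 1) ≡ suc (suc (suc n)) ∸ shift y
      rotate-old y y<n = begin
        at w′ (at w′ (suc (shift y)) ∸ 1)     ≡⟨ cong (λ x → at w′ (x ∸ 1)) (trans (at-w′-middle (shift y) (shift<n+2 y y<n)) (at-m-old y y<n)) ⟩
        at w′ (suc (shift (v y)))             ≡⟨ at-w′-middle (shift (v y)) (shift<n+2 (v y) (v-< y y<n)) ⟩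
        at m (shift (v y))                    ≡⟨ at-m-old (v y) (v-< y y<n) ⟩
        suc (suc (shift (v (v y))))           ≡⟨ cong (λ t → suc (suc (shift t))) (v∘v y y<n) ⟩
        suc (suc (shift (c y)))               ≡⟨ m+n∸n≡m (suc (suc (shift (c y)))) (shift y) ⟨
        suc (suc (shift (c y) + shift y)) ∸ shift y ≡⟨ cong (λ t → suc (suc t) ∸ shift y) (shift-complement y y<n) ⟩
        suc (suc (suc n)) ∸ shift y           ∎
        where open ≡-Reasoning

      rotate : ∀ i → i < suc (suc (suc (suc n))) → at w′ (at w′ i ∸ 1) ≡ suc (suc (suc (suc n))) ∸ i
      rotate zero    _           = rotate-first
      rotate (suc x) (s≤s x<n+3) with m≤n⇒m<n∨m≡n (≤-pred x<n+3)
      ... | inj₂ refl = rotate-last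
      ... | inj₁ x<n+2 with position-view x x<n+2
      ...   | is-max refl       = rotate-max
      ...   | is-min refl       = rotate-min
      ...   | is-old y y<n refl = rotate-old y y<n

      w′-rotation-fixed : RotFixed w′
      w′-rotation-fixed i i<w′ =
        trans (rotate i (subst (i <_) length-w′ i<w′)) (cong (_∸ i) (sym length-w′))

      w′-perm : IsPerm (n + 4) w′
      w′-perm = subst (λ t → w′ ↭ applyUpTo suc t) (+-comm 4 n) (begin
        w′                                                                ≡⟨ w′≡ ⟩
        a ∷ (m ++ b ∷ [])                                                 ≡⟨ cong (λ xs → a ∷ (xs ++ b ∷ [])) m≡layout ⟩
        a ∷ (layout 1 N u ++ b ∷ [])                                      ↭⟨ framed-layout-↭ a 1 N b u ⟩
        a ∷ 1 ∷ N ∷ b ∷ u                                                 ↭⟨ prep a (prep 1 (prep N (prep b (map⁺ relabel w↭)))) ⟩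
        a ∷ 1 ∷ N ∷ b ∷ relabelled-range                                  ↭⟨ swap a 1 ↭-refl ⟩
        1 ∷ a ∷ N ∷ b ∷ relabelled-range                                  ↭⟨ prep 1 (↭-shift b (a ∷ N ∷ []) relabelled-range) ⟩
        1 ∷ b ∷ a ∷ N ∷ relabelled-range                                  ↭⟨ framed-layout-↭ 1 b a N relabelled-range ⟨
        1 ∷ (layout b a relabelled-range ++ N ∷ [])                       ≡⟨ cong (1 ∷_) layout-relabelled-range ⟨
        applyUpTo suc N                                                   ∎)
        where
        open PermutationReasoning
        a = suc (suc p)
        b = suc (suc (suc (suc K)))
        N = suc (suc (suc (suc n)))

      extension : RotationFixedExtension n w p
      extension = w′ , w′-perm , w′-baxter , w′-rotation-fixed , _ , _ , m , u , w′≡ , 1∈m , removeOne-m , standardize-u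

RotationFixedExtension-reverse : ∀ n w p → p ≤ n → length w ≡ n →
                                 RotationFixedExtension n (reverse w) (n ∸ p) → RotationFixedExtension n w p
RotationFixedExtension-reverse n w p p≤n w≡n (w′ , w′↭ , bax , rot , a , b , m , u , w′≡ , 1∈m , removeOne-m , std-u) =
  reverse w′ , ↭-trans (↭-reverse w′) w′↭ ,
  Baxter-reverse w′ bax ,
  RotFixed-reverse (n + 4) w′ w′↭ rot ,
  b , a , reverse m , reverse u , reverse-w′≡ , ∈-resp-↭ (↭-sym (↭-reverse m)) 1∈m , removeOne-reverse-m , std-reverse-u
  where
  open ≡-Reasoning
  u≡n : length u ≡ n
  u≡n = trans (sym (length-map _ u)) (trans (cong length std-u) (trans (length-reverse w) w≡n))
  reverse-w′≡ : reverse w′ ≡ b ∷ (reverse m ++ a ∷ [])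
  reverse-w′≡ = trans (cong reverse w′≡) (trans (unfold-reverse a (m ++ b ∷ [])) (cong (_++ a ∷ []) (reverse-++ m (b ∷ []))))
  removeOne-reverse-m : removeOne (reverse m) ≡ insertAt p (n + 4) (reverse u)
  removeOne-reverse-m = begin
    removeOne (reverse m)                               ≡⟨ filter-reverse (λ x → ¬? (x ≟ 1)) m ⟩
    reverse (removeOne m)                               ≡⟨ cong reverse removeOne-m ⟩
    reverse (insertAt (n ∸ p) (n + 4) u)                ≡⟨ reverse-insertAt (n ∸ p) (n + 4) u ⟩
    insertAt (length u ∸ (n ∸ p)) (n + 4) (reverse u)   ≡⟨ cong (λ t → insertAt (t ∸ (n ∸ p)) (n + 4) (reverse u)) u≡n ⟩
    insertAt (n ∸ (n ∸ p)) (n + 4) (reverse u)          ≡⟨ cong (λ t → insertAt t (n + 4) (reverse u)) (m∸[m∸n]≡n p≤n) ⟩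
    insertAt p (n + 4) (reverse u)                      ∎
  std-reverse-u : standardize (reverse u) ≡ w
  std-reverse-u = trans (standardize-reverse u) (trans (cong reverse std-u) (reverse-involutive w))

extension-in-left-half : ∀ n w p → IsPerm n w → Baxter w → RotFixed w → p + p < n →
                         Baxter (insertAt p (suc n) w) → RotationFixedExtension n w p
extension-in-left-half n w p w↭ bax rot p+p<n bax+ =
  Construction.extension w length-w at-w w↭ (Baxter⇒NoBaxterPattern (insertAt p (suc n) w) bax+)
  where
  open OneLine n w w↭
  p<n = ≤-<-trans (m≤m+n p p) p+p<n
  p≤K : p ≤ complement n p
  p≤K = subst (_≤ n ∸ suc p) (m+n∸n≡m p p) (∸-monoˡ-≤ (suc p) p+p<n)
  open RotationFixedBaxter n v v-< (v∘v rot) (v-baxter bax)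
  open Gap p p<n p≤K (no-3142-with-max p p<n bax+) (no-2413-with-max p p<n bax+)

extension-in-right-half : ∀ n w p → IsPerm n w → Baxter w → RotFixed w → p ≤ n → n < p + p →
                          Baxter (insertAt p (suc n) w) → RotationFixedExtension n w p
extension-in-right-half n w p w↭ bax rot p≤n n<p+p bax+ =
  RotationFixedExtension-reverse n w p p≤n length-w
    (extension-in-left-half n (reverse w) q (↭-trans (↭-reverse w) w↭)
      (Baxter-reverse w bax) (RotFixed-reverse n w w↭ rot) q+q<n
      (subst Baxter (trans (reverse-insertAt p (suc n) w) (cong (λ t → insertAt (t ∸ p) (suc n) (reverse w)) length-w))
        (Baxter-reverse (insertAt p (suc n) w) bax+)))
  where
  open OneLine n w w↭
  q = n ∸ p
  p+q≡n : p + q ≡ n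
  p+q≡n = m+[n∸m]≡n p≤n
  q<p : q < p
  q<p = +-cancelˡ-< p q p (subst (_< p + p) (sym p+q≡n) n<p+p)
  q+q<n : q + q < n
  q+q<n = subst (q + q <_) (trans (+-comm q p) p+q≡n) (+-monoʳ-< q q<p)

p+p≢length : ∀ n w p → 1 ≤ n → IsPerm n w → Baxter w → RotFixed w → p + p ≢ n
p+p≢length n w zero    1≤n _  _   _   p+p≡n = <⇒≢ 1≤n p+p≡n
p+p≢length n w (suc h) _   w↭ bax rot p+p≡n = n-odd h (sym p+p≡n)
  where
  open OneLine n w w↭
  open RotationFixedBaxter n v v-< (v∘v rot) (v-baxter bax)

theorem5p5 : (n : ℕ) → 1 ≤ n → (w : List ℕ) → IsPerm n w → Baxter w → RotFixed w →
    (p : ℕ) → p ≤ n → Baxter (insertAt p (suc n) w) →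
    ∃[ w' ] (IsPerm (n + 4) w' × Baxter w' × RotFixed w' ×
      ∃[ a ] ∃[ b ] ∃[ m ] ∃[ u ]
        (w' ≡ a ∷ (m ++ b ∷ []) × 1 ∈ m ×
         removeOne m ≡ insertAt p (n + 4) u × standardize u ≡ w))
theorem5p5 n 1≤n w w↭ bax rot p p≤n bax+ with <-cmp (p + p) n
... | tri< p+p<n _ _ = extension-in-left-half n w p w↭ bax rot p+p<n bax+
... | tri≈ _ p+p≡n _ = ⊥-elim (p+p≢length n w p 1≤n w↭ bax rot p+p≡n)
... | tri> _ _ n<p+p = extension-in-right-half n w p w↭ bax rot p≤n n<p+p bax+
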